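{- For every $n\ge1$ and $0\le k\le n-1$, \[ n\,s_{(n-k,1^k)}=\sum_{J\subseteq[n],\ |J|>k}(-1)^{|J|-k-1}F^{\mathrm{cyc}}_{n,J} \quad\text{and}\quad s_{(n-k,1^k)}=\sum_{A,\ r(A)>k}(-1)^{r(A)-k-1}\hat F^{\mathrm{cyc}}_{n,A}, \] the latter sum over cyclic orbits $A$ of nonempty subsets of $[n]$.
   Context: $s_{(n-k,1^k)}$ is the Schur function of the hook shape. For $J\subseteq[n]$, $F^{\mathrm{cyc}}_{n,J}:=\sum_{(w,k')}x_{w_1}\cdots x_{w_n}$ over pairs $w\in\{1,2,\dots\}^n$, $k'\in[n]$ with $w_{k'}\le\cdots\le w_n\le w_1\le\cdots\le w_{k'-1}$ and $w_j<w_{j+1}$ for $j\in J\setminus\{k'-1\}$ (indices mod $n$). $\mathbb{Z}/n\mathbb{Z}$ acts on subsets of $[n]$ by cyclic shifts; for an orbit $A$, $r(A)$ is the common cardinality of its elements, $d_A$ the order of the stabilizer of any $J\in A$, and $\hat F^{\mathrm{cyc}}_{n,A}:=F^{\mathrm{cyc}}_{n,J}/d_A$ for $J\in A$. -}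

module Defs where

open import Data.Bool using (Bool; true; false; _∧_; _∨_; not; if_then_else_)
open import Data.Nat as ℕ using (ℕ; zero; suc; _+_; _∸_; _≤ᵇ_; _<ᵇ_; _≡ᵇ_)
open import Data.Nat.DivMod using (_%_; m%n<n)
open import Data.Fin as Fin using (Fin; toℕ; fromℕ<)
open import Data.Fin.Subset using (Subset; ∣_∣)
open import Data.List as List using (List; []; _∷_; [_]; map; concat; concatMap; allFin; replicate; cartesianProduct; foldr)
open import Data.Vec as Vec using (Vec; lookup; tabulate; toList)
open import Data.Product using (_×_; _,_)
open import Data.Integer as ℤ using (ℤ; +_; -[1+_])
open import Data.Rational as ℚ using (ℚ)

countL : {A : Set} → (A → Bool) → List A → ℕ
countL p [] = 0
countL p (x ∷ xs) = if p x then suc (countL p xs) else countL p xs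

allB : {A : Set} → (A → Bool) → List A → Bool
allB p [] = true
allB p (x ∷ xs) = p x ∧ allB p xs

allVecsOf : {A : Set} → List A → (n : ℕ) → List (Vec A n)
allVecsOf xs zero = [ Vec.[] ]
allVecsOf xs (suc n) = concatMap (λ x → map (x Vec.∷_) (allVecsOf xs n)) xs

-- all subsets of [n] (positions 0..n-1 stand for 1..n)
allSubsets : (n : ℕ) → List (Subset n)
allSubsets n = allVecsOf (false ∷ true ∷ []) n

sumℤ : List ℤ → ℤ
sumℤ = foldr ℤ._+_ (+ 0)

sumℚ : List ℚ → ℚ
sumℚ = foldr ℚ._+_ ℚ.0ℚ

signPow : ℕ → ℤ
signPow zero = + 1
signPow (suc e) = ℤ.- signPow e

-- A word w over Fin m
-- stands for the monomial x_{w_1} ⋯ x_{w_n}; α : Fin m → ℕ is an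
-- exponent vector, and "hasContent w α" says the monomial of w is x^α.

_≤F_ _<F_ _≡F_ : {m : ℕ} → Fin m → Fin m → Bool
a ≤F b = toℕ a ≤ᵇ toℕ b
a <F b = toℕ a <ᵇ toℕ b
a ≡F b = toℕ a ≡ᵇ toℕ b

hasContent : {m : ℕ} → List (Fin m) → (Fin m → ℕ) → Bool
hasContent {m} w α = allB (λ i → countL (λ x → x ≡F i) w ≡ᵇ α i) (allFin m)

-- Schur functions: coefficient of x^α in s_λ (restricted to m variables)
-- = number of semistandard Young tableaux of shape λ (English notation,
-- rows listed top to bottom) with entries in Fin m and content α.

weakInc : {m : ℕ} → List (Fin m) → Bool
weakInc (a ∷ b ∷ r) = (a ≤F b) ∧ weakInc (b ∷ r)
weakInc _ = true

colStrict : {m : ℕ} → List (Fin m) → List (Fin m) → Bool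
colStrict (a ∷ as) (b ∷ bs) = (a <F b) ∧ colStrict as bs
colStrict _ _ = true

isSSYT : {m : ℕ} → List (List (Fin m)) → Bool
isSSYT [] = true
isSSYT (r ∷ []) = weakInc r
isSSYT (r ∷ r' ∷ T) = weakInc r ∧ colStrict r r' ∧ isSSYT (r' ∷ T)

fillings : {m : ℕ} → List ℕ → List (List (List (Fin m)))
fillings [] = [ [] ]
fillings {m} (l ∷ ls) =
  concatMap (λ r → map (toList r ∷_) (fillings ls)) (allVecsOf (allFin m) l)

schurCoeff : {m : ℕ} → List ℕ → (Fin m → ℕ) → ℕ
schurCoeff lam α = countL (λ T → isSSYT T ∧ hasContent (concat T) α) (fillings lam)

hook : ℕ → ℕ → List ℕ
hook n k = (n ∸ k) ∷ replicate k 1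

-- Cyclic arithmetic on Fin n (position i ∈ Fin n stands for i+1 ∈ [n])

addMod : {n : ℕ} → Fin n → Fin n → Fin n
addMod {suc n} i s = fromℕ< (m%n<n (toℕ i + toℕ s) (suc n))

sucMod : {n : ℕ} → Fin n → Fin n
sucMod {suc n} i = fromℕ< (m%n<n (suc (toℕ i)) (suc n))

predMod : {n : ℕ} → Fin n → Fin n
predMod {suc n} i = fromℕ< (m%n<n (toℕ i + n) (suc n))

-- Cyclic fundamental quasisymmetric functions: coefficient of x^α in
-- F^cyc_{n,J} (restricted to m variables) = number of pairs (w , k')
-- with w_{k'} ≤ ⋯ ≤ w_n ≤ w_1 ≤ ⋯ ≤ w_{k'-1} and w_j < w_{j+1} for
-- j ∈ J ∖ {k'-1} (indices mod n), and monomial x^α.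
-- The chain condition says: w_j ≤ w_{j+1} for every j ≠ k'-1 (mod n).

cycOK : {n m : ℕ} → Subset n → Vec (Fin m) n → Fin n → Bool
cycOK {n} J w k' =
  allB (λ j → (j ≡F predMod k')
              ∨ ((lookup w j ≤F lookup w (sucMod j))
                 ∧ (not (lookup J j) ∨ (lookup w j <F lookup w (sucMod j)))))
       (allFin n)

fcycCoeff : {n m : ℕ} → Subset n → (Fin m → ℕ) → ℕ
fcycCoeff {n} {m} J α =
  countL (λ { (w , k') → cycOK J w k' ∧ hasContent (toList w) α })
         (cartesianProduct (allVecsOf (allFin m) n) (allFin n))

shift : {n : ℕ} → Fin n → Subset n → Subset n
shift s J = tabulate (λ i → lookup J (addMod i s))

eqSub : {n : ℕ} → Subset n → Subset n → Bool
eqSub Vec.[] Vec.[] = true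
eqSub (a Vec.∷ as) (b Vec.∷ bs) = (if a then b else not b) ∧ eqSub as bs

lexLeq : {n : ℕ} → Subset n → Subset n → Bool
lexLeq Vec.[] Vec.[] = true
lexLeq (false Vec.∷ as) (false Vec.∷ bs) = lexLeq as bs
lexLeq (true Vec.∷ as) (true Vec.∷ bs) = lexLeq as bs
lexLeq (false Vec.∷ as) (true Vec.∷ bs) = true
lexLeq (true Vec.∷ as) (false Vec.∷ bs) = false

-- J is the chosen representative of its orbit A (its lex-minimal element);
-- summing over such J is summing over the orbits A.
isOrbitRep : {n : ℕ} → Subset n → Bool
isOrbitRep {n} J = allB (λ s → lexLeq J (shift s J)) (allFin n)

stabOrder : {n : ℕ} → Subset n → ℕ
stabOrder {n} J = countL (λ s → eqSub (shift s J) J) (allFin n)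

-- q / d in ℚ (d ≥ 1 always holds for stabilizer orders; d = 0 never occurs)
divℕ : ℚ → ℕ → ℚ
divℕ q zero = ℚ.0ℚ
divℕ q (suc d) = q ℚ.* ((+ 1) ℚ./ suc d)

-- coefficient of x^α in  \hat F^cyc_{n,A} = F^cyc_{n,J} / d_A   (J ∈ A)
fcycHatCoeff : {n m : ℕ} → Subset n → (Fin m → ℕ) → ℚ
fcycHatCoeff J α = divℕ ((ℤ.+ fcycCoeff J α) ℚ./ 1) (stabOrder J)

rhsSubsets : (n k : ℕ) {m : ℕ} → (Fin m → ℕ) → ℤ
rhsSubsets n k α =
  sumℤ (map (λ J → if k <ᵇ ∣ J ∣
                     then signPow (∣ J ∣ ∸ k ∸ 1) ℤ.* (+ fcycCoeff J α)
                     else + 0)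
            (allSubsets n))

rhsOrbits : (n k : ℕ) {m : ℕ} → (Fin m → ℕ) → ℚ
rhsOrbits n k α =
  sumℚ (map (λ J → if isOrbitRep J ∧ (0 <ᵇ ∣ J ∣) ∧ (k <ᵇ ∣ J ∣)
                     then ((signPow (∣ J ∣ ∸ k ∸ 1)) ℚ./ 1) ℚ.* fcycHatCoeff J α
                     else ℚ.0ℚ)
            (allSubsets n))

module Submission where

-- Both sides are reduced to  ascentSum = Σ_u C(asc u, k),  the sum over the
-- weakly increasing words u of content α, asc u = number of strict ascents.
--  (A) A hook tableau is determined by its leg: a strictly increasing choice of
--      k letters of u above min u (there are asc u of them); the first row is
--      the rest.  Hence [x^α] s_(N-k,1^k) = ascentSum.
--  (B) Cutting the cycle at k', a cyclic pair (w , k') is the rotated word,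
--      weakly increasing and strict on the rotated set J: F^cyc_J = Σ_{k'} E(J_{k'}).
--  (C) The signed sum over J of (B) is N · Σ_X (term of X cut at 0); the terms of
--      0∷Y and 1∷Y telescope to |Y| = k, and the k-subsets of the ascents of u
--      number C(asc u, k).  Hence the subset side is N · ascentSum.
--  (D) A shift-invariant sum over subsets is Σ_{orbit reps} |orbit| · term, and
--      |orbit| · d_A = N; so the orbit side is the subset side divided by N.

open import Defs
open import Data.Bool using (Bool; true; false; _∧_; _∨_; not; if_then_else_; T)
open import Data.Bool.Properties as BoolP using ()
open import Data.Empty using (⊥; ⊥-elim)
open import Data.Fin as Fin using (Fin; toℕ; fromℕ<; inject₁; lower₁)
open import Data.Fin.Properties as FinP using ()
open import Data.Fin.Subset using (Subset; ∣_∣)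
open import Data.Integer as ℤ using (ℤ; +_; _+_; _*_)
open import Data.Integer.Properties as ℤP using ()
open import Data.List as List using (List; []; _∷_; map; concatMap; _++_; allFin; cartesianProduct)
open import Data.List.Properties as ListP using ()
open import Data.Nat as ℕ using (ℕ; zero; suc; _<_; _≤_; _∸_; _≡ᵇ_; _<ᵇ_)
open import Data.Nat.Combinatorics using (_C_; nCk+nC[k+1]≡[n+1]C[k+1])
open import Data.Nat.Combinatorics.Specification using (k>n⇒nCk≡0)
open import Data.Nat.DivMod using (_%_; m%n<n; %-distribˡ-+; m%n%n≡m%n; m<n⇒m%n≡m; [m+n]%n≡m%n; n%n≡0)
open import Data.Nat.Properties as ℕP using ()
open import Data.Product using (_×_; _,_; proj₁; proj₂; Σ-syntax; ∃)
open import Data.Rational as ℚ using (ℚ; 0ℚ; 1ℚ)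
open import Data.Rational.Properties as ℚP using ()
open import Data.Rational.Unnormalised as ℚᵘ using (mkℚᵘ; *≡*)
open import Data.Rational.Unnormalised.Properties as ℚᵘP using ()
open import Data.Vec as Vec using (Vec; lookup; tabulate; toList)
open import Data.Vec.Properties as VecP using ()
open import Relation.Binary.Definitions using (DecidableEquality)
open import Relation.Binary.PropositionalEquality
open import Relation.Nullary using (yes; no; ¬_)
open import Function.Bundles using (Equivalence)
open import Algebra.Properties.CommutativeSemigroup ℤP.+-commutativeSemigroup using (interchange)
open import Algebra.Properties.CommutativeSemigroup ℕP.+-commutativeSemigroup using () renaming (x∙yz≈y∙xz to ℕ-x∙yz≈y∙xz)

Σ : {A : Set} → List A → (A → ℤ) → ℤ
Σ l f = sumℤ (map f l)

ι : Bool → ℤ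
ι true = + 1
ι false = + 0

Σ-cong : {A : Set} (l : List A) {f g : A → ℤ} → (∀ x → f x ≡ g x) → Σ l f ≡ Σ l g
Σ-cong [] e = refl
Σ-cong (x ∷ l) e = cong₂ _+_ (e x) (Σ-cong l e)

Σ-0 : {A : Set} (l : List A) → Σ l (λ _ → + 0) ≡ + 0
Σ-0 [] = refl
Σ-0 (x ∷ l) = trans (ℤP.+-identityˡ _) (Σ-0 l)

Σ-++ : {A : Set} (xs ys : List A) (f : A → ℤ) → Σ (xs ++ ys) f ≡ Σ xs f + Σ ys f
Σ-++ [] ys f = sym (ℤP.+-identityˡ _)
Σ-++ (x ∷ xs) ys f = trans (cong (λ z → f x + z) (Σ-++ xs ys f)) (sym (ℤP.+-assoc (f x) _ _))

Σ-map : {A B : Set} (g : A → B) (xs : List A) (f : B → ℤ) → Σ (map g xs) f ≡ Σ xs (λ x → f (g x))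
Σ-map g [] f = refl
Σ-map g (x ∷ xs) f = cong (λ z → f (g x) + z) (Σ-map g xs f)

Σ-concatMap : {A B : Set} (g : A → List B) (xs : List A) (f : B → ℤ) →
  Σ (concatMap g xs) f ≡ Σ xs (λ x → Σ (g x) f)
Σ-concatMap g [] f = refl
Σ-concatMap g (x ∷ xs) f = trans (Σ-++ (g x) (concatMap g xs) f) (cong (λ z → Σ (g x) f + z) (Σ-concatMap g xs f))

Σ-+ : {A : Set} (l : List A) (f g : A → ℤ) → Σ l (λ x → f x + g x) ≡ Σ l f + Σ l g
Σ-+ [] f g = refl
Σ-+ (x ∷ l) f g = trans (cong (λ z → f x + g x + z) (Σ-+ l f g)) (interchange (f x) (g x) _ _)

Σ-*ˡ : {A : Set} (l : List A) (c : ℤ) (f : A → ℤ) → Σ l (λ x → c * f x) ≡ c * Σ l f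
Σ-*ˡ [] c f = sym (ℤP.*-zeroʳ c)
Σ-*ˡ (x ∷ l) c f = trans (cong (λ z → c * f x + z) (Σ-*ˡ l c f)) (sym (ℤP.*-distribˡ-+ c (f x) _))

Σ-*ʳ : {A : Set} (l : List A) (c : ℤ) (f : A → ℤ) → Σ l (λ x → f x * c) ≡ Σ l f * c
Σ-*ʳ l c f = trans (Σ-cong l (λ x → ℤP.*-comm (f x) c)) (trans (Σ-*ˡ l c f) (ℤP.*-comm c _))

Σ-swap : {A B : Set} (xs : List A) (ys : List B) (f : A → B → ℤ) →
  Σ xs (λ x → Σ ys (f x)) ≡ Σ ys (λ y → Σ xs (λ x → f x y))
Σ-swap [] ys f = sym (Σ-0 ys)
Σ-swap (x ∷ xs) ys f = trans (cong (λ z → Σ ys (f x) + z) (Σ-swap xs ys f))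
  (sym (Σ-+ ys (f x) (λ y → Σ xs (λ x' → f x' y))))

Σ-cart : {A B : Set} (xs : List A) (ys : List B) (f : A × B → ℤ) →
  Σ (cartesianProduct xs ys) f ≡ Σ xs (λ x → Σ ys (λ y → f (x , y)))
Σ-cart [] ys f = refl
Σ-cart (x ∷ xs) ys f = trans (Σ-++ (map (x ,_) ys) _ f) (cong₂ _+_ (Σ-map (x ,_) ys f) (Σ-cart xs ys f))

Σ-if : {A : Set} (l : List A) (b : Bool) (c : ℤ) (f : A → ℤ) →
  Σ l (λ x → if b then c * f x else + 0) ≡ (if b then c * Σ l f else + 0)
Σ-if l true c f = Σ-*ˡ l c f
Σ-if l false c f = Σ-0 l

countL-Σ : {A : Set} (p : A → Bool) (l : List A) → + countL p l ≡ Σ l (λ x → ι (p x))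
countL-Σ p [] = refl
countL-Σ p (x ∷ l) with p x
... | true = cong (λ z → + 1 + z) (countL-Σ p l)
... | false = trans (countL-Σ p l) (sym (ℤP.+-identityˡ _))

Σ-tabulate : {n : ℕ} {A : Set} (f : Fin n → A) (g : A → ℤ) →
  Σ (List.tabulate f) g ≡ Σ (allFin n) (λ i → g (f i))
Σ-tabulate {zero} f g = refl
Σ-tabulate {suc n} f g = cong (λ z → g (f Fin.zero) + z)
  (trans (Σ-tabulate (λ i → f (Fin.suc i)) g) (sym (Σ-tabulate Fin.suc (λ i → g (f i)))))

Σ-allFin-suc : {n : ℕ} (g : Fin (suc n) → ℤ) →
  Σ (allFin (suc n)) g ≡ g Fin.zero + Σ (allFin n) (λ i → g (Fin.suc i))
Σ-allFin-suc g = cong (λ z → g Fin.zero + z) (Σ-tabulate Fin.suc g)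

Σ-const : (n : ℕ) (c : ℤ) → Σ (allFin n) (λ _ → c) ≡ + n * c
Σ-const zero c = sym (ℤP.*-zeroˡ c)
Σ-const (suc n) c = begin
  Σ (allFin (suc n)) (λ _ → c) ≡⟨ Σ-allFin-suc {n} (λ _ → c) ⟩
  c + Σ (allFin n) (λ _ → c)   ≡⟨ cong (λ z → c + z) (Σ-const n c) ⟩
  c + + n * c                  ≡⟨ cong (_+ + n * c) (sym (ℤP.*-identityˡ c)) ⟩
  + 1 * c + + n * c            ≡⟨ sym (ℤP.*-distribʳ-+ c (+ 1) (+ n)) ⟩
  + suc n * c ∎
  where open ≡-Reasoning

Σ-vecs-suc : {A : Set} (xs : List A) (n : ℕ) (f : Vec A (suc n) → ℤ) →
  Σ (allVecsOf xs (suc n)) f ≡ Σ xs (λ x → Σ (allVecsOf xs n) (λ v → f (x Vec.∷ v)))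
Σ-vecs-suc xs n f = trans (Σ-concatMap (λ x → map (x Vec.∷_) (allVecsOf xs n)) xs f)
  (Σ-cong xs (λ x → Σ-map (x Vec.∷_) (allVecsOf xs n) f))

Σ-subsets-suc : {n : ℕ} (f : Subset (suc n) → ℤ) →
  Σ (allSubsets (suc n)) f ≡ Σ (allSubsets n) (λ Y → f (false Vec.∷ Y)) + Σ (allSubsets n) (λ Y → f (true Vec.∷ Y))
Σ-subsets-suc {n} f = trans (Σ-vecs-suc (false ∷ true ∷ []) n f)
  (cong (λ z → Σ (allSubsets n) (λ Y → f (false Vec.∷ Y)) + z) (ℤP.+-identityʳ _))

abstract
  δ : {A : Set} → DecidableEquality A → A → A → ℤ
  δ eq x y with eq x y
  ... | yes _ = + 1
  ... | no _ = + 0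

  δ-yes : {A : Set} (eq : DecidableEquality A) {x y : A} → x ≡ y → δ eq x y ≡ + 1
  δ-yes eq {x} {y} p with eq x y
  ... | yes _ = refl
  ... | no np = ⊥-elim (np p)

  δ-no : {A : Set} (eq : DecidableEquality A) {x y : A} → ¬ x ≡ y → δ eq x y ≡ + 0
  δ-no eq {x} {y} np with eq x y
  ... | yes p = ⊥-elim (np p)
  ... | no _ = refl

  δ-sym : {A : Set} (eq : DecidableEquality A) (x y : A) → δ eq x y ≡ δ eq y x
  δ-sym eq x y with eq x y
  ... | yes p = sym (δ-yes eq (sym p))
  ... | no np = sym (δ-no eq (λ q → np (sym q)))

  δ-subst : {A : Set} (eq : DecidableEquality A) (a x : A) (f : A → ℤ) →
    δ eq x a * f x ≡ δ eq x a * f a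
  δ-subst eq a x f with eq x a
  ... | yes refl = refl
  ... | no _ = refl

  δ-iff : {A B : Set} (e1 : DecidableEquality A) (e2 : DecidableEquality B) {x y : A} {x' y' : B} →
    (x ≡ y → x' ≡ y') → (x' ≡ y' → x ≡ y) → δ e1 x y ≡ δ e2 x' y'
  δ-iff e1 e2 {x} {y} f g with e1 x y
  ... | yes p = sym (δ-yes e2 (f p))
  ... | no np = sym (δ-no e2 (λ q → np (g q)))

record Enum (A : Set) : Set where
  field
    eq : DecidableEquality A
    elems : List A
    once : ∀ a → Σ elems (λ x → δ eq x a) ≡ + 1
open Enum public

Σ-δ : {A : Set} (E : Enum A) (a : A) (f : A → ℤ) →
  Σ (elems E) (λ x → δ (eq E) x a * f x) ≡ f a
Σ-δ E a f = begin
  Σ (elems E) (λ x → δ (eq E) x a * f x) ≡⟨ Σ-cong (elems E) (λ x → δ-subst (eq E) a x f) ⟩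
  Σ (elems E) (λ x → δ (eq E) x a * f a) ≡⟨ Σ-*ʳ (elems E) (f a) _ ⟩
  Σ (elems E) (λ x → δ (eq E) x a) * f a ≡⟨ cong (_* f a) (once E a) ⟩
  + 1 * f a                              ≡⟨ ℤP.*-identityˡ (f a) ⟩
  f a ∎
  where open ≡-Reasoning

Σ-unique : {A : Set} (E : Enum A) (p : A → Bool) (a : A) →
  (∀ x → p x ≡ true → x ≡ a) → Σ (elems E) (λ x → ι (p x)) ≡ ι (p a)
Σ-unique E p a u = trans (Σ-cong (elems E) localise) (Σ-δ E a (λ x → ι (p x)))
  where
  localise : ∀ x → ι (p x) ≡ δ (eq E) x a * ι (p x)
  localise x with eq E x a | p x in px
  ... | yes q | _ = sym (trans (cong (_* _) (δ-yes (eq E) q)) (ℤP.*-identityˡ _))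
  ... | no x≢a | true = ⊥-elim (x≢a (u x px))
  ... | no _ | false = sym (ℤP.*-zeroʳ (δ (eq E) x a))

Σ-bij : {A : Set} (E : Enum A) (g h : A → A) →
  (∀ x → h (g x) ≡ x) → (∀ y → g (h y) ≡ y) → (f : A → ℤ) →
  Σ (elems E) (λ x → f (g x)) ≡ Σ (elems E) f
Σ-bij E g h hg gh f = begin
  Σ l (λ x → f (g x))                         ≡⟨ Σ-cong l (λ x → sym (Σ-δ E (g x) f)) ⟩
  Σ l (λ x → Σ l (λ y → δ e y (g x) * f y)) ≡⟨ Σ-swap l l _ ⟩
  Σ l (λ y → Σ l (λ x → δ e y (g x) * f y)) ≡⟨ Σ-cong l (λ y → Σ-*ʳ l (f y) (λ x → δ e y (g x))) ⟩
  Σ l (λ y → Σ l (λ x → δ e y (g x)) * f y) ≡⟨ Σ-cong l (λ y → cong (_* f y) (preimage-once y)) ⟩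
  Σ l (λ y → + 1 * f y)                       ≡⟨ Σ-cong l (λ y → ℤP.*-identityˡ (f y)) ⟩
  Σ l f ∎
  where
  open ≡-Reasoning
  l = elems E
  e = eq E
  preimage-once : ∀ y → Σ l (λ x → δ e y (g x)) ≡ + 1
  preimage-once y = trans (Σ-cong l (λ x → δ-iff e e (λ p → trans (sym (hg x)) (cong h (sym p)))
                                                     (λ q → trans (sym (gh y)) (cong g (sym q)))))
                          (once E (h y))

finOnce : (n : ℕ) (a : Fin n) → Σ (allFin n) (λ x → δ FinP._≟_ x a) ≡ + 1
finOnce (suc n) Fin.zero = trans (Σ-allFin-suc (λ x → δ FinP._≟_ x Fin.zero))
  (cong₂ _+_ (δ-yes FinP._≟_ refl) (trans (Σ-cong (allFin n) (λ i → δ-no FinP._≟_ λ ())) (Σ-0 (allFin n))))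
finOnce (suc n) (Fin.suc a) = trans (Σ-allFin-suc (λ x → δ FinP._≟_ x (Fin.suc a)))
  (cong₂ _+_ (δ-no FinP._≟_ λ ()) (trans (Σ-cong (allFin n) δ-suc) (finOnce n a)))
  where
  δ-suc : ∀ i → δ FinP._≟_ (Fin.suc i) (Fin.suc a) ≡ δ FinP._≟_ i a
  δ-suc i = δ-iff FinP._≟_ FinP._≟_ FinP.suc-injective (cong Fin.suc)

EnumFin : (n : ℕ) → Enum (Fin n)
EnumFin n = record { eq = FinP._≟_ ; elems = allFin n ; once = finOnce n }

EnumBool : Enum Bool
EnumBool = record { eq = BoolP._≟_ ; elems = false ∷ true ∷ [] ; once = boolOnce }
  where
  boolOnce : (a : Bool) → Σ (false ∷ true ∷ []) (λ x → δ BoolP._≟_ x a) ≡ + 1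
  boolOnce false = cong₂ _+_ (δ-yes BoolP._≟_ {false} refl) (cong (_+ + 0) (δ-no BoolP._≟_ {true} {false} λ ()))
  boolOnce true = cong₂ _+_ (δ-no BoolP._≟_ {false} {true} λ ()) (cong (_+ + 0) (δ-yes BoolP._≟_ {true} refl))

module _ {A : Set} (E : Enum A) where
  private
    _≟ᵛ_ : {k : ℕ} → DecidableEquality (Vec A k)
    _≟ᵛ_ = VecP.≡-dec (eq E)

  δ-∷ : {n : ℕ} (x a : A) (v w : Vec A n) → δ _≟ᵛ_ (x Vec.∷ v) (a Vec.∷ w) ≡ δ (eq E) x a * δ _≟ᵛ_ v w
  δ-∷ x a v w with eq E x a | v ≟ᵛ w
  ... | yes p | yes q = trans (δ-yes _≟ᵛ_ (cong₂ Vec._∷_ p q)) (sym (cong₂ _*_ (δ-yes (eq E) p) (δ-yes _≟ᵛ_ q)))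
  ... | yes _ | no v≢w = trans (δ-no _≟ᵛ_ (λ r → v≢w (proj₂ (VecP.∷-injective r))))
        (sym (trans (cong (δ (eq E) x a *_) (δ-no _≟ᵛ_ v≢w)) (ℤP.*-zeroʳ (δ (eq E) x a))))
  ... | no x≢a | _ = trans (δ-no _≟ᵛ_ (λ r → x≢a (proj₁ (VecP.∷-injective r))))
        (sym (trans (cong (_* δ _≟ᵛ_ v w) (δ-no (eq E) x≢a)) (ℤP.*-zeroˡ (δ _≟ᵛ_ v w))))

  vecOnce : (n : ℕ) (a : Vec A n) → Σ (allVecsOf (elems E) n) (λ v → δ _≟ᵛ_ v a) ≡ + 1
  vecOnce zero Vec.[] = cong (_+ + 0) (δ-yes _≟ᵛ_ {Vec.[]} refl)
  vecOnce (suc n) (a Vec.∷ as) = begin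
    Σ (allVecsOf l (suc n)) (λ v → δ _≟ᵛ_ v (a Vec.∷ as))
      ≡⟨ Σ-vecs-suc l n _ ⟩
    Σ l (λ x → Σ (allVecsOf l n) (λ v → δ _≟ᵛ_ (x Vec.∷ v) (a Vec.∷ as)))
      ≡⟨ Σ-cong l (λ x → Σ-cong (allVecsOf l n) (λ v → δ-∷ x a v as)) ⟩
    Σ l (λ x → Σ (allVecsOf l n) (λ v → δ (eq E) x a * δ _≟ᵛ_ v as))
      ≡⟨ Σ-cong l (λ x → Σ-*ˡ (allVecsOf l n) (δ (eq E) x a) _) ⟩
    Σ l (λ x → δ (eq E) x a * Σ (allVecsOf l n) (λ v → δ _≟ᵛ_ v as))
      ≡⟨ Σ-cong l (λ x → trans (cong (δ (eq E) x a *_) (vecOnce n as)) (ℤP.*-identityʳ _)) ⟩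
    Σ l (λ x → δ (eq E) x a)
      ≡⟨ once E a ⟩
    + 1 ∎
    where
    open ≡-Reasoning
    l = elems E

  EnumVec : (n : ℕ) → Enum (Vec A n)
  EnumVec n = record { eq = _≟ᵛ_ ; elems = allVecsOf (elems E) n ; once = vecOnce n }

EnumSub : (n : ℕ) → Enum (Subset n)
EnumSub = EnumVec EnumBool

bool-ext : {a b : Bool} → (a ≡ true → b ≡ true) → (b ≡ true → a ≡ true) → a ≡ b
bool-ext {false} {false} f g = refl
bool-ext {false} {true} f g = g refl
bool-ext {true} {false} f g = sym (f refl)
bool-ext {true} {true} f g = refl

true≢false : true ≢ false
true≢false ()

T→≡ : {b : Bool} → T b → b ≡ true
T→≡ = Equivalence.to BoolP.T-≡

≡→T : {b : Bool} → b ≡ true → T b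
≡→T = Equivalence.from BoolP.T-≡

∧-true : {a b : Bool} → a ∧ b ≡ true → (a ≡ true) × (b ≡ true)
∧-true {true} {true} _ = refl , refl

∧-intro : {a b : Bool} → a ≡ true → b ≡ true → a ∧ b ≡ true
∧-intro refl refl = refl

∨-introˡ : {a b : Bool} → a ≡ true → a ∨ b ≡ true
∨-introˡ refl = refl

∨-introʳ : {a b : Bool} → b ≡ true → a ∨ b ≡ true
∨-introʳ {true} _ = refl
∨-introʳ {false} h = h

∨-elimʳ : {a b : Bool} → a ∨ b ≡ true → a ≡ false → b ≡ true
∨-elimʳ {false} h refl = h

∧-interchange : (a b c d : Bool) → (a ∧ b) ∧ (c ∧ d) ≡ (a ∧ c) ∧ (b ∧ d)
∧-interchange true b true d = refl
∧-interchange true b false d = BoolP.∧-zeroʳ b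
∧-interchange false b c d = refl

ι-∧ : (a b : Bool) → ι (a ∧ b) ≡ ι a * ι b
ι-∧ true true = refl
ι-∧ true false = refl
ι-∧ false b = sym (ℤP.*-zeroˡ (ι b))

ι-*-cong : (b : Bool) {x y : ℤ} → (b ≡ true → x ≡ y) → ι b * x ≡ ι b * y
ι-*-cong true e = cong (+ 1 *_) (e refl)
ι-*-cong false {x} {y} e = trans (ℤP.*-zeroˡ x) (sym (ℤP.*-zeroˡ y))

allB-tabulate : {A : Set} {n : ℕ} (f : Fin n → A) (p : A → Bool) →
  allB p (List.tabulate f) ≡ allB (λ i → p (f i)) (allFin n)
allB-tabulate {n = zero} f p = refl
allB-tabulate {n = suc n} f p = cong (p (f Fin.zero) ∧_)
  (trans (allB-tabulate (λ i → f (Fin.suc i)) p) (sym (allB-tabulate Fin.suc (λ i → p (f i)))))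

allB-suc : {n : ℕ} (p : Fin (suc n) → Bool) → allB p (allFin (suc n)) ≡ p Fin.zero ∧ allB (λ i → p (Fin.suc i)) (allFin n)
allB-suc p = cong (p Fin.zero ∧_) (allB-tabulate Fin.suc p)

allB→ : {n : ℕ} (p : Fin n → Bool) → allB p (allFin n) ≡ true → ∀ i → p i ≡ true
allB→ {suc n} p h Fin.zero = proj₁ (∧-true (trans (sym (allB-suc p)) h))
allB→ {suc n} p h (Fin.suc i) = allB→ (λ j → p (Fin.suc j)) (proj₂ (∧-true (trans (sym (allB-suc p)) h))) i

→allB : {n : ℕ} (p : Fin n → Bool) → (∀ i → p i ≡ true) → allB p (allFin n) ≡ true
→allB {zero} p h = refl
→allB {suc n} p h = trans (allB-suc p) (∧-intro (h Fin.zero) (→allB (λ j → p (Fin.suc j)) (λ j → h (Fin.suc j))))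

allB-cong : {A : Set} (l : List A) {p q : A → Bool} → (∀ x → p x ≡ q x) → allB p l ≡ allB q l
allB-cong [] e = refl
allB-cong (x ∷ l) e = cong₂ _∧_ (e x) (allB-cong l e)

allB-∧ : {A : Set} (l : List A) (p q : A → Bool) → allB (λ x → p x ∧ q x) l ≡ allB p l ∧ allB q l
allB-∧ [] p q = refl
allB-∧ (x ∷ l) p q = trans (cong ((p x ∧ q x) ∧_) (allB-∧ l p q)) (∧-interchange (p x) (q x) _ _)

bit : Bool → ℕ
bit true = 1
bit false = 0

countL-cong : {A : Set} (l : List A) {p q : A → Bool} → (∀ x → p x ≡ q x) → countL p l ≡ countL q l
countL-cong [] e = refl
countL-cong (x ∷ l) {p} {q} e rewrite e x with q x
... | true = cong suc (countL-cong l e)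
... | false = countL-cong l e

countL-∷ : {A : Set} (p : A → Bool) (x : A) (l : List A) → countL p (x ∷ l) ≡ bit (p x) ℕ.+ countL p l
countL-∷ p x l with p x
... | true = refl
... | false = refl

countL-tabulate : {A : Set} {n : ℕ} (f : Fin n → A) (p : A → Bool) →
  countL p (List.tabulate f) ≡ countL (λ i → p (f i)) (allFin n)
countL-tabulate {n = zero} f p = refl
countL-tabulate {n = suc n} f p =
  trans (countL-∷ p (f Fin.zero) (List.tabulate (λ i → f (Fin.suc i))))
  (trans (cong (bit (p (f Fin.zero)) ℕ.+_) (trans (countL-tabulate (λ i → f (Fin.suc i)) p) (sym (countL-tabulate Fin.suc (λ i → p (f i))))))
         (sym (countL-∷ (λ i → p (f i)) Fin.zero (List.tabulate Fin.suc))))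

countL-false : {A : Set} (l : List A) → countL (λ _ → false) l ≡ 0
countL-false [] = refl
countL-false (x ∷ l) = countL-false l

countL-∨ : {A : Set} (l : List A) (p q : A → Bool) → (∀ x → p x ∧ q x ≡ false) →
  countL (λ x → p x ∨ q x) l ≡ countL p l ℕ.+ countL q l
countL-∨ [] p q d = refl
countL-∨ (x ∷ l) p q d with p x in e1 | q x in e2
... | true | true = ⊥-elim (true≢false (trans (sym (cong₂ _∧_ e1 e2)) (d x)))
... | true | false = cong suc (countL-∨ l p q d)
... | false | true = trans (cong suc (countL-∨ l p q d)) (sym (ℕP.+-suc (countL p l) _))
... | false | false = countL-∨ l p q d

countL-witness : {A : Set} (p : A → Bool) (l : List A) → 0 < countL p l → ∃ λ x → p x ≡ true
countL-witness p (x ∷ l) h with p x in e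
... | true = x , e
... | false = countL-witness p l h

countFin : {m : ℕ} → (Fin m → Bool) → ℕ
countFin {m} U = countL U (allFin m)

countFin-suc : {m : ℕ} (U : Fin (suc m) → Bool) → countFin U ≡ bit (U Fin.zero) ℕ.+ countFin (λ i → U (Fin.suc i))
countFin-suc U = trans (countL-∷ U Fin.zero (List.tabulate Fin.suc)) (cong (bit (U Fin.zero) ℕ.+_) (countL-tabulate Fin.suc U))

countFin-pos : {N : ℕ} (p : Fin N → Bool) (s : Fin N) → p s ≡ true → 0 < countFin p
countFin-pos {suc N} p Fin.zero e rewrite countFin-suc p | e = ℕ.s≤s ℕ.z≤n
countFin-pos {suc N} p (Fin.suc s) e rewrite countFin-suc p =
  ℕP.<-≤-trans (countFin-pos (λ i → p (Fin.suc i)) s e) (ℕP.m≤n+m _ _)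

countL-toList : {A : Set} {n : ℕ} (p : A → Bool) (v : Vec A n) →
  + countL p (toList v) ≡ Σ (allFin n) (λ j → ι (p (lookup v j)))
countL-toList p Vec.[] = refl
countL-toList p (x Vec.∷ v) = trans (countL-Σ p (x ∷ toList v))
  (trans (cong (λ z → ι (p x) + z) (trans (sym (countL-Σ p (toList v))) (countL-toList p v)))
         (sym (Σ-allFin-suc (λ j → ι (p (lookup (x Vec.∷ v) j))))))

card-Σ : {n : ℕ} (J : Subset n) → + ∣ J ∣ ≡ Σ (allFin n) (λ j → ι (lookup J j))
card-Σ Vec.[] = refl
card-Σ (true Vec.∷ J) = trans (cong (λ z → + 1 + z) (card-Σ J)) (sym (Σ-allFin-suc (λ j → ι (lookup (true Vec.∷ J) j))))
card-Σ (false Vec.∷ J) = trans (trans (card-Σ J) (sym (ℤP.+-identityˡ _))) (sym (Σ-allFin-suc (λ j → ι (lookup (false Vec.∷ J) j))))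

card-∷ : {n : ℕ} (x : Bool) (X : Subset n) → ∣ x Vec.∷ X ∣ ≡ bit x ℕ.+ ∣ X ∣
card-∷ true X = refl
card-∷ false X = refl

module _ {m : ℕ} {a b : Fin m} where
  ≤F→ : (a ≤F b) ≡ true → toℕ a ≤ toℕ b
  ≤F→ h = ℕP.≤ᵇ⇒≤ (toℕ a) (toℕ b) (≡→T h)
  →≤F : toℕ a ≤ toℕ b → (a ≤F b) ≡ true
  →≤F h = T→≡ (ℕP.≤⇒≤ᵇ h)
  <F→ : (a <F b) ≡ true → toℕ a < toℕ b
  <F→ h = ℕP.<ᵇ⇒< (toℕ a) (toℕ b) (≡→T h)
  →<F : toℕ a < toℕ b → (a <F b) ≡ true
  →<F h = T→≡ (ℕP.<⇒<ᵇ h)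
  ≡F→ : (a ≡F b) ≡ true → a ≡ b
  ≡F→ h = FinP.toℕ-injective (ℕP.≡ᵇ⇒≡ (toℕ a) (toℕ b) (≡→T h))
  →≡F : a ≡ b → (a ≡F b) ≡ true
  →≡F refl = T→≡ (ℕP.≡⇒≡ᵇ (toℕ a) (toℕ a) refl)
  ≢→≡F : ¬ a ≡ b → (a ≡F b) ≡ false
  ≢→≡F ne with a ≡F b in e
  ... | true = ⊥-elim (ne (≡F→ e))
  ... | false = refl
  ≮→<F : ¬ toℕ a < toℕ b → (a <F b) ≡ false
  ≮→<F ne with a <F b in e
  ... | true = ⊥-elim (ne (<F→ e))
  ... | false = refl

+-inj : {a b : ℕ} → + a ≡ + b → a ≡ b
+-inj refl = refl

module Cyclic {n : ℕ} where
  private N = suc n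

  modId : (i : Fin N) → toℕ i % N ≡ toℕ i
  modId i = m<n⇒m%n≡m (FinP.toℕ<n i)

  finMod : (x y : Fin N) → toℕ x % N ≡ toℕ y % N → x ≡ y
  finMod x y e = FinP.toℕ-injective (trans (sym (modId x)) (trans e (modId y)))

  +mod : (a a' b b' : ℕ) → a % N ≡ a' % N → b % N ≡ b' % N → (a ℕ.+ b) % N ≡ (a' ℕ.+ b') % N
  +mod a a' b b' ea eb = trans (%-distribˡ-+ a b N)
    (trans (cong₂ (λ x y → (x ℕ.+ y) % N) ea eb) (sym (%-distribˡ-+ a' b' N)))

  addMod≈ : (i s : Fin N) → toℕ (addMod i s) % N ≡ (toℕ i ℕ.+ toℕ s) % N
  addMod≈ i s = trans (cong (_% N) (FinP.toℕ-fromℕ< (m%n<n (toℕ i ℕ.+ toℕ s) N))) (m%n%n≡m%n (toℕ i ℕ.+ toℕ s) N)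

  sucMod≈ : (i : Fin N) → toℕ (sucMod i) % N ≡ suc (toℕ i) % N
  sucMod≈ i = trans (cong (_% N) (FinP.toℕ-fromℕ< (m%n<n (suc (toℕ i)) N))) (m%n%n≡m%n (suc (toℕ i)) N)

  predMod≈ : (i : Fin N) → toℕ (predMod i) % N ≡ (toℕ i ℕ.+ n) % N
  predMod≈ i = trans (cong (_% N) (FinP.toℕ-fromℕ< (m%n<n (toℕ i ℕ.+ n) N))) (m%n%n≡m%n (toℕ i ℕ.+ n) N)

  addMod-assoc : (i a b : Fin N) → addMod (addMod i a) b ≡ addMod i (addMod a b)
  addMod-assoc i a b = finMod _ _ (begin
    toℕ (addMod (addMod i a) b) % N     ≡⟨ addMod≈ (addMod i a) b ⟩
    (toℕ (addMod i a) ℕ.+ toℕ b) % N   ≡⟨ +mod (toℕ (addMod i a)) (toℕ i ℕ.+ toℕ a) (toℕ b) (toℕ b) (addMod≈ i a) refl ⟩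
    (toℕ i ℕ.+ toℕ a ℕ.+ toℕ b) % N    ≡⟨ cong (_% N) (ℕP.+-assoc (toℕ i) _ _) ⟩
    (toℕ i ℕ.+ (toℕ a ℕ.+ toℕ b)) % N  ≡⟨ +mod (toℕ i) (toℕ i) (toℕ a ℕ.+ toℕ b) (toℕ (addMod a b)) refl (sym (addMod≈ a b)) ⟩
    (toℕ i ℕ.+ toℕ (addMod a b)) % N   ≡⟨ sym (addMod≈ i (addMod a b)) ⟩
    toℕ (addMod i (addMod a b)) % N ∎)
    where open ≡-Reasoning

  addMod-comm : (a b : Fin N) → addMod a b ≡ addMod b a
  addMod-comm a b = finMod _ _ (trans (addMod≈ a b) (trans (cong (_% N) (ℕP.+-comm (toℕ a) _)) (sym (addMod≈ b a))))

  addMod-zero : (i : Fin N) → addMod i Fin.zero ≡ i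
  addMod-zero i = finMod _ _ (trans (addMod≈ i Fin.zero) (cong (_% N) (ℕP.+-identityʳ (toℕ i))))

  negMod : Fin N → Fin N
  negMod a = fromℕ< (m%n<n (N ∸ toℕ a) N)

  addMod-neg : (a : Fin N) → addMod a (negMod a) ≡ Fin.zero
  addMod-neg a = finMod _ _ (begin
    toℕ (addMod a (negMod a)) % N   ≡⟨ addMod≈ a (negMod a) ⟩
    (toℕ a ℕ.+ toℕ (negMod a)) % N ≡⟨ +mod (toℕ a) (toℕ a) (toℕ (negMod a)) (N ∸ toℕ a) refl neg≈ ⟩
    (toℕ a ℕ.+ (N ∸ toℕ a)) % N    ≡⟨ cong (_% N) (ℕP.m+[n∸m]≡n (ℕP.<⇒≤ (FinP.toℕ<n a))) ⟩
    N % N                           ≡⟨ n%n≡0 N ⟩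
    0 ∎)
    where
    open ≡-Reasoning
    neg≈ : toℕ (negMod a) % N ≡ (N ∸ toℕ a) % N
    neg≈ = trans (cong (_% N) (FinP.toℕ-fromℕ< (m%n<n (N ∸ toℕ a) N))) (m%n%n≡m%n (N ∸ toℕ a) N)

  addMod-neg' : (a : Fin N) → addMod (negMod a) a ≡ Fin.zero
  addMod-neg' a = trans (addMod-comm (negMod a) a) (addMod-neg a)

  addMod-cancel : (i a : Fin N) → addMod (addMod i a) (negMod a) ≡ i
  addMod-cancel i a = trans (addMod-assoc i a (negMod a)) (trans (cong (addMod i) (addMod-neg a)) (addMod-zero i))

  addMod-cancel' : (i a : Fin N) → addMod (addMod i (negMod a)) a ≡ i
  addMod-cancel' i a = trans (addMod-assoc i (negMod a) a) (trans (cong (addMod i) (addMod-neg' a)) (addMod-zero i))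

  last : Fin N
  last = predMod Fin.zero

  toℕ-last : toℕ last ≡ n
  toℕ-last = trans (FinP.toℕ-fromℕ< (m%n<n (0 ℕ.+ n) N)) (m<n⇒m%n≡m (ℕP.n<1+n n))

  predMod-translate : (k : Fin N) → predMod k ≡ addMod k last
  predMod-translate k = finMod _ _ (trans (predMod≈ k)
    (trans (+mod (toℕ k) (toℕ k) n (toℕ last) refl (cong (_% N) (sym toℕ-last))) (sym (addMod≈ k last))))

  -- Rotation of a vector: (rot s v)_i = v_{i+s}.  Note  shift = rot  on subsets.
  rot : {A : Set} → Fin N → Vec A N → Vec A N
  rot s v = tabulate (λ i → lookup v (addMod i s))

  lookup-rot : {A : Set} (s : Fin N) (v : Vec A N) (i : Fin N) → lookup (rot s v) i ≡ lookup v (addMod i s)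
  lookup-rot s v i = VecP.lookup∘tabulate (λ j → lookup v (addMod j s)) i

  rot-comp : {A : Set} (a b : Fin N) (v : Vec A N) → rot b (rot a v) ≡ rot (addMod b a) v
  rot-comp a b v = VecP.tabulate-cong (λ i → trans (lookup-rot a v (addMod i b)) (cong (lookup v) (addMod-assoc i b a)))

  rot-zero : {A : Set} (v : Vec A N) → rot Fin.zero v ≡ v
  rot-zero v = trans (VecP.tabulate-cong (λ i → cong (lookup v) (addMod-zero i))) (VecP.tabulate∘lookup v)

  rot-inv : {A : Set} (a : Fin N) (v : Vec A N) → rot (negMod a) (rot a v) ≡ v
  rot-inv a v = trans (rot-comp a (negMod a) v) (trans (cong (λ z → rot z v) (addMod-neg' a)) (rot-zero v))

  rot-inv' : {A : Set} (a : Fin N) (v : Vec A N) → rot a (rot (negMod a) v) ≡ v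
  rot-inv' a v = trans (rot-comp (negMod a) a v) (trans (cong (λ z → rot z v) (addMod-neg a)) (rot-zero v))

  rot-injective : {A : Set} (a : Fin N) (X Y : Vec A N) → rot a X ≡ rot a Y → X ≡ Y
  rot-injective a X Y e = trans (sym (rot-inv a X)) (trans (cong (rot (negMod a)) e) (rot-inv a Y))

  Σ-rot : {A : Set} (E : Enum A) (a : Fin N) (f : Vec A N → ℤ) →
    Σ (elems (EnumVec E N)) (λ v → f (rot a v)) ≡ Σ (elems (EnumVec E N)) f
  Σ-rot E a f = Σ-bij (EnumVec E N) (rot a) (rot (negMod a)) (rot-inv a) (rot-inv' a) f

  Σ-translate : (a : Fin N) (f : Fin N → ℤ) → Σ (allFin N) (λ i → f (addMod i a)) ≡ Σ (allFin N) f
  Σ-translate a f = Σ-bij (EnumFin N) (λ i → addMod i a) (λ i → addMod i (negMod a))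
    (λ i → addMod-cancel i a) (λ i → addMod-cancel' i a) f

  countL-rot : {A : Set} (p : A → Bool) (a : Fin N) (v : Vec A N) → countL p (toList (rot a v)) ≡ countL p (toList v)
  countL-rot p a v = +-inj (begin
    + countL p (toList (rot a v))                 ≡⟨ countL-toList p (rot a v) ⟩
    Σ (allFin N) (λ j → ι (p (lookup (rot a v) j))) ≡⟨ Σ-cong (allFin N) (λ j → cong (λ z → ι (p z)) (lookup-rot a v j)) ⟩
    Σ (allFin N) (λ j → ι (p (lookup v (addMod j a)))) ≡⟨ Σ-translate a (λ j → ι (p (lookup v j))) ⟩
    Σ (allFin N) (λ j → ι (p (lookup v j)))      ≡⟨ sym (countL-toList p v) ⟩
    + countL p (toList v) ∎)
    where open ≡-Reasoning

  card-rot : (a : Fin N) (J : Subset N) → ∣ rot a J ∣ ≡ ∣ J ∣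
  card-rot a J = +-inj (begin
    + ∣ rot a J ∣                               ≡⟨ card-Σ (rot a J) ⟩
    Σ (allFin N) (λ j → ι (lookup (rot a J) j)) ≡⟨ Σ-cong (allFin N) (λ j → cong ι (lookup-rot a J j)) ⟩
    Σ (allFin N) (λ j → ι (lookup J (addMod j a))) ≡⟨ Σ-translate a (λ j → ι (lookup J j)) ⟩
    Σ (allFin N) (λ j → ι (lookup J j))        ≡⟨ sym (card-Σ J) ⟩
    + ∣ J ∣ ∎)
    where open ≡-Reasoning

  content-rot : {m : ℕ} (α : Fin m → ℕ) (a : Fin N) (v : Vec (Fin m) N) →
    hasContent (toList (rot a v)) α ≡ hasContent (toList v) α
  content-rot {m} α a v = allB-cong (allFin m) (λ i → cong (_≡ᵇ α i) (countL-rot (λ x → x ≡F i) a v))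

  -- Cutting the cycle at k: position i < n of the path starting at k is the
  -- cyclic position i + k; its successor is i+1 on the path, and the only
  -- cyclic position not of this form is predMod k, where the path ends.
  sucMod-path : (i : Fin n) (k : Fin N) → sucMod (addMod (inject₁ i) k) ≡ addMod (Fin.suc i) k
  sucMod-path i k = finMod _ _ (begin
    toℕ (sucMod (addMod (inject₁ i) k)) % N ≡⟨ sucMod≈ (addMod (inject₁ i) k) ⟩
    (1 ℕ.+ toℕ (addMod (inject₁ i) k)) % N ≡⟨ +mod 1 1 (toℕ (addMod (inject₁ i) k)) (toℕ (inject₁ i) ℕ.+ toℕ k) refl (addMod≈ (inject₁ i) k) ⟩
    (1 ℕ.+ (toℕ (inject₁ i) ℕ.+ toℕ k)) % N ≡⟨ cong (λ z → (1 ℕ.+ (z ℕ.+ toℕ k)) % N) (FinP.toℕ-inject₁ i) ⟩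
    (toℕ (Fin.suc i) ℕ.+ toℕ k) % N         ≡⟨ sym (addMod≈ (Fin.suc i) k) ⟩
    toℕ (addMod (Fin.suc i) k) % N ∎)
    where open ≡-Reasoning

  path-predMod : (i : Fin n) (k : Fin N) → addMod (Fin.suc i) (predMod k) ≡ addMod (inject₁ i) k
  path-predMod i k = finMod _ _ (begin
    toℕ (addMod (Fin.suc i) (predMod k)) % N ≡⟨ addMod≈ (Fin.suc i) (predMod k) ⟩
    (suc (toℕ i) ℕ.+ toℕ (predMod k)) % N    ≡⟨ +mod (suc (toℕ i)) (suc (toℕ i)) (toℕ (predMod k)) (toℕ k ℕ.+ n) refl (predMod≈ k) ⟩
    (suc (toℕ i) ℕ.+ (toℕ k ℕ.+ n)) % N      ≡⟨ cong (_% N) (regroup (toℕ i) (toℕ k)) ⟩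
    (toℕ i ℕ.+ toℕ k ℕ.+ N) % N              ≡⟨ [m+n]%n≡m%n (toℕ i ℕ.+ toℕ k) N ⟩
    (toℕ i ℕ.+ toℕ k) % N                    ≡⟨ cong (λ z → (z ℕ.+ toℕ k) % N) (sym (FinP.toℕ-inject₁ i)) ⟩
    (toℕ (inject₁ i) ℕ.+ toℕ k) % N          ≡⟨ sym (addMod≈ (inject₁ i) k) ⟩
    toℕ (addMod (inject₁ i) k) % N ∎)
    where
    open ≡-Reasoning
    regroup : ∀ a b → suc a ℕ.+ (b ℕ.+ n) ≡ a ℕ.+ b ℕ.+ N
    regroup a b = trans (cong suc (sym (ℕP.+-assoc a b n))) (sym (ℕP.+-suc (a ℕ.+ b) n))

  path-avoids-end : (i : Fin n) (k : Fin N) → ¬ addMod (inject₁ i) k ≡ predMod k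
  path-avoids-end i k e = ℕP.<-irrefl refl (subst (ℕ._< n) toℕ-i≡n (FinP.toℕ<n i))
    where
    i≡last : inject₁ i ≡ last
    i≡last = trans (sym (addMod-cancel (inject₁ i) k))
      (trans (cong (λ z → addMod z (negMod k)) (trans e (trans (predMod-translate k) (addMod-comm k last))))
             (addMod-cancel last k))
    toℕ-i≡n : toℕ i ≡ n
    toℕ-i≡n = trans (sym (FinP.toℕ-inject₁ i)) (trans (cong toℕ i≡last) toℕ-last)

  path-covers : (j k : Fin N) → ¬ j ≡ predMod k → ∃ λ (i : Fin n) → addMod (inject₁ i) k ≡ j
  path-covers j k j≢end = lower₁ i' n≢i' , trans (cong (λ z → addMod z k) (FinP.inject₁-lower₁ i' n≢i')) (addMod-cancel' j k)
    where
    i' = addMod j (negMod k)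
    n≢i' : ¬ n ≡ toℕ i'
    n≢i' e = j≢end (trans (sym (addMod-cancel' j k))
      (trans (cong (λ z → addMod z k) (FinP.toℕ-injective (trans (sym e) (sym toℕ-last))))
             (trans (addMod-comm last k) (sym (predMod-translate k)))))

_⊆ᵇ_ : {n : ℕ} → Subset n → Subset n → Bool
_⊆ᵇ_ {n} Y A = allB (λ i → not (lookup Y i) ∨ lookup A i) (allFin n)

0C[1+k]≡0 : (k : ℕ) → 0 C suc k ≡ 0
0C[1+k]≡0 k = k>n⇒nCk≡0 {0} {suc k} (ℕ.s≤s ℕ.z≤n)

k-subsets-split : {n : ℕ} (a : Bool) (A : Subset n) (k : ℕ) →
  Σ (allSubsets (suc n)) (λ Y → ι ((∣ Y ∣ ≡ᵇ k) ∧ (Y ⊆ᵇ (a Vec.∷ A))))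
  ≡ Σ (allSubsets n) (λ Y → ι ((∣ Y ∣ ≡ᵇ k) ∧ (Y ⊆ᵇ A)))
    + Σ (allSubsets n) (λ Y → ι ((suc ∣ Y ∣ ≡ᵇ k) ∧ (a ∧ (Y ⊆ᵇ A))))
k-subsets-split {n} a A k = trans (Σ-subsets-suc (λ Y → ι ((∣ Y ∣ ≡ᵇ k) ∧ (Y ⊆ᵇ (a Vec.∷ A))))) (cong₂ _+_
  (Σ-cong (allSubsets n) (λ Y → cong (λ z → ι ((∣ Y ∣ ≡ᵇ k) ∧ z)) (allB-suc (λ i → not (lookup (false Vec.∷ Y) i) ∨ lookup (a Vec.∷ A) i))))
  (Σ-cong (allSubsets n) (λ Y → cong (λ z → ι ((suc ∣ Y ∣ ≡ᵇ k) ∧ z)) (allB-suc (λ i → not (lookup (true Vec.∷ Y) i) ∨ lookup (a Vec.∷ A) i)))))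

k-subsets : {n : ℕ} (A : Subset n) (k : ℕ) →
  Σ (allSubsets n) (λ Y → ι ((∣ Y ∣ ≡ᵇ k) ∧ (Y ⊆ᵇ A))) ≡ + (∣ A ∣ C k)
k-subsets Vec.[] zero = refl
k-subsets Vec.[] (suc k) = cong +_ (sym (0C[1+k]≡0 k))
k-subsets {suc n} (false Vec.∷ A) k = begin
  _ ≡⟨ k-subsets-split false A k ⟩
  _ ≡⟨ cong₂ _+_ (k-subsets A k) (trans (Σ-cong (allSubsets n) (λ Y → cong ι (BoolP.∧-zeroʳ (suc ∣ Y ∣ ≡ᵇ k)))) (Σ-0 (allSubsets n))) ⟩
  + (∣ A ∣ C k) + + 0 ≡⟨ ℤP.+-identityʳ _ ⟩
  + (∣ A ∣ C k) ∎
  where open ≡-Reasoning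
k-subsets {suc n} (true Vec.∷ A) zero = begin
  _ ≡⟨ k-subsets-split true A zero ⟩
  _ ≡⟨ cong₂ _+_ (k-subsets A zero) (Σ-0 (allSubsets n)) ⟩
  + 1 ∎
  where open ≡-Reasoning
k-subsets {suc n} (true Vec.∷ A) (suc k) = begin
  _ ≡⟨ k-subsets-split true A (suc k) ⟩
  _ ≡⟨ cong₂ _+_ (k-subsets A (suc k)) (k-subsets A k) ⟩
  + (∣ A ∣ C suc k) + + (∣ A ∣ C k) ≡⟨ cong +_ (ℕP.+-comm (∣ A ∣ C suc k) _) ⟩
  + (∣ A ∣ C k ℕ.+ ∣ A ∣ C suc k)  ≡⟨ cong +_ (nCk+nC[k+1]≡[n+1]C[k+1] ∣ A ∣ k) ⟩
  + (suc ∣ A ∣ C suc k) ∎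
  where open ≡-Reasoning

sign-telescope : (c k : ℕ) (e : ℤ) →
  (if k <ᵇ c then signPow (c ∸ k ∸ 1) * e else + 0)
    + (if k <ᵇ suc c then signPow (suc c ∸ k ∸ 1) * e else + 0)
  ≡ ι (c ≡ᵇ k) * e
sign-telescope zero zero e = ℤP.+-identityˡ (+ 1 * e)
sign-telescope zero (suc k) e = sym (ℤP.*-zeroˡ e)
sign-telescope (suc c) zero e = begin
  signPow c * e + ℤ.- signPow c * e       ≡⟨ cong (λ z → signPow c * e + z) (sym (ℤP.neg-distribˡ-* (signPow c) e)) ⟩
  signPow c * e + ℤ.- (signPow c * e)     ≡⟨ ℤP.+-inverseʳ (signPow c * e) ⟩
  + 0                                     ≡⟨ sym (ℤP.*-zeroˡ e) ⟩
  + 0 * e ∎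
  where open ≡-Reasoning
sign-telescope (suc c) (suc k) e = sign-telescope c k e

-- (B) Unrolling the cyclic chain condition of F^cyc_{N,J}

module Unrolling {n m : ℕ} where
  open Cyclic {n}
  private
    N = suc n
    Word = Vec (Fin m) N

  stepOK : Word → Subset n → Fin n → Bool
  stepOK u Y i = (lookup u (inject₁ i) ≤F lookup u (Fin.suc i))
               ∧ (not (lookup Y i) ∨ (lookup u (inject₁ i) <F lookup u (Fin.suc i)))

  increasingAt : Word → Subset n → Bool
  increasingAt u Y = allB (stepOK u Y) (allFin n)

  cycStep : Subset N → Word → Fin N → Bool
  cycStep J w j = (lookup w j ≤F lookup w (sucMod j))
                ∧ (not (lookup J j) ∨ (lookup w j <F lookup w (sucMod j)))

  -- The descent set as seen by the path cut open at k.
  cutAt : Fin N → Subset N → Subset n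
  cutAt k J = Vec.tail (rot (predMod k) J)

  cycStep-path : (J : Subset N) (w : Word) (k : Fin N) (i : Fin n) →
    cycStep J w (addMod (inject₁ i) k) ≡ stepOK (rot k w) (cutAt k J) i
  cycStep-path J w k i
    rewrite sucMod-path i k | lookup-rot k w (inject₁ i) | lookup-rot k w (Fin.suc i)
          | lookup-rot (predMod k) J (Fin.suc i) | path-predMod i k = refl

  cycOK-unrolled : (J : Subset N) (w : Word) (k : Fin N) →
    cycOK J w k ≡ increasingAt (rot k w) (cutAt k J)
  cycOK-unrolled J w k = bool-ext to from
    where
    to : cycOK J w k ≡ true → increasingAt (rot k w) (cutAt k J) ≡ true
    to h = →allB (stepOK (rot k w) (cutAt k J)) λ i → trans (sym (cycStep-path J w k i))
      (∨-elimʳ (allB→ (λ j → (j ≡F predMod k) ∨ cycStep J w j) h (addMod (inject₁ i) k))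
               (≢→≡F (path-avoids-end i k)))
    from : increasingAt (rot k w) (cutAt k J) ≡ true → cycOK J w k ≡ true
    from h = →allB (λ j → (j ≡F predMod k) ∨ cycStep J w j) step
      where
      step : (j : Fin N) → ((j ≡F predMod k) ∨ cycStep J w j) ≡ true
      step j with j FinP.≟ predMod k
      ... | yes j≡end = ∨-introˡ (→≡F j≡end)
      ... | no j≢end = ∨-introʳ (subst (λ x → cycStep J w x ≡ true) (proj₂ (path-covers j k j≢end))
                                       (trans (cycStep-path J w k i) (allB→ (stepOK (rot k w) (cutAt k J)) h i)))
        where i = proj₁ (path-covers j k j≢end)

  weaklyIncreasing : Word → Bool
  weaklyIncreasing u = allB (λ i → lookup u (inject₁ i) ≤F lookup u (Fin.suc i)) (allFin n)

  ascents : Word → Subset n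
  ascents u = tabulate (λ i → lookup u (inject₁ i) <F lookup u (Fin.suc i))

  increasingAt-split : (u : Word) (Y : Subset n) → increasingAt u Y ≡ weaklyIncreasing u ∧ (Y ⊆ᵇ ascents u)
  increasingAt-split u Y = trans (allB-∧ (allFin n) _ _) (cong (weaklyIncreasing u ∧_)
    (allB-cong (allFin n) (λ i → cong (not (lookup Y i) ∨_)
      (sym (VecP.lookup∘tabulate (λ i → lookup u (inject₁ i) <F lookup u (Fin.suc i)) i)))))

  module _ (α : Fin m → ℕ) where
    private
      words = allVecsOf (allFin m) N
      hasα : Word → Bool
      hasα u = hasContent (toList u) α

    E : Subset n → ℤ
    E Y = Σ words (λ u → ι (increasingAt u Y ∧ hasα u))

    fcyc-unrolled : (J : Subset N) → + fcycCoeff J α ≡ Σ (allFin N) (λ k → E (cutAt k J))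
    fcyc-unrolled J = begin
      + fcycCoeff J α
        ≡⟨ countL-Σ _ (cartesianProduct words (allFin N)) ⟩
      Σ (cartesianProduct words (allFin N)) (λ p → ι (pairOK p))
        ≡⟨ Σ-cart words (allFin N) (λ p → ι (pairOK p)) ⟩
      Σ words (λ w → Σ (allFin N) (λ k → ι (cycOK J w k ∧ hasα w)))
        ≡⟨ Σ-swap words (allFin N) _ ⟩
      Σ (allFin N) (λ k → Σ words (λ w → ι (cycOK J w k ∧ hasα w)))
        ≡⟨ Σ-cong (allFin N) (λ k → Σ-cong words (λ w →
             cong₂ (λ x y → ι (x ∧ y)) (cycOK-unrolled J w k) (sym (content-rot α k w)))) ⟩
      Σ (allFin N) (λ k → Σ words (λ w → ι (increasingAt (rot k w) (cutAt k J) ∧ hasα (rot k w))))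
        ≡⟨ Σ-cong (allFin N) (λ k → Σ-rot (EnumFin m) k (λ u → ι (increasingAt u (cutAt k J) ∧ hasα u))) ⟩
      Σ (allFin N) (λ k → E (cutAt k J)) ∎
      where
      open ≡-Reasoning
      pairOK : Word × Fin N → Bool
      pairOK = λ { (w , k') → cycOK J w k' ∧ hasContent (toList w) α }

    fcyc-rot : (t : Fin N) (J : Subset N) → fcycCoeff (rot t J) α ≡ fcycCoeff J α
    fcyc-rot t J = +-inj (begin
      + fcycCoeff (rot t J) α                              ≡⟨ fcyc-unrolled (rot t J) ⟩
      Σ (allFin N) (λ k → E (cutAt k (rot t J)))          ≡⟨ Σ-cong (allFin N) (λ k → cong E (cut-rot k)) ⟩
      Σ (allFin N) (λ k → E (cutAt (addMod k t) J))       ≡⟨ Σ-translate t (λ k → E (cutAt k J)) ⟩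
      Σ (allFin N) (λ k → E (cutAt k J))                  ≡⟨ sym (fcyc-unrolled J) ⟩
      + fcycCoeff J α ∎)
      where
      open ≡-Reasoning
      predMod-+ : ∀ k → addMod (predMod k) t ≡ predMod (addMod k t)
      predMod-+ k = begin
        addMod (predMod k) t          ≡⟨ cong (λ z → addMod z t) (predMod-translate k) ⟩
        addMod (addMod k last) t      ≡⟨ addMod-assoc k last t ⟩
        addMod k (addMod last t)      ≡⟨ cong (addMod k) (addMod-comm last t) ⟩
        addMod k (addMod t last)      ≡⟨ sym (addMod-assoc k t last) ⟩
        addMod (addMod k t) last      ≡⟨ sym (predMod-translate (addMod k t)) ⟩
        predMod (addMod k t) ∎
      cut-rot : ∀ k → cutAt k (rot t J) ≡ cutAt (addMod k t) J
      cut-rot k = cong Vec.tail (trans (rot-comp t (predMod k) J) (cong (λ z → rot z J) (predMod-+ k)))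

ascentSum : (n k : ℕ) {m : ℕ} → (Fin m → ℕ) → ℤ
ascentSum n k {m} α = Σ (allVecsOf (allFin m) (suc n))
  (λ u → ι (weaklyIncreasing u ∧ hasContent (toList u) α) * + (∣ ascents u ∣ C k))
  where open Unrolling {n} {m}

-- (C) The signed sum over all subsets J

ι-regroup : (a c s h : Bool) → ι a * ι ((c ∧ s) ∧ h) ≡ ι (c ∧ h) * ι (a ∧ s)
ι-regroup true true true true = refl
ι-regroup true true true false = refl
ι-regroup true true false true = refl
ι-regroup true true false false = refl
ι-regroup true false s h = refl
ι-regroup false true true true = refl
ι-regroup false true true false = refl
ι-regroup false true false true = refl
ι-regroup false true false false = refl
ι-regroup false false s h = refl

module SubsetSide {n m : ℕ} (k : ℕ) (α : Fin m → ℕ) where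
  open Cyclic {n}
  open Unrolling {n} {m}
  private
    N = suc n
    subsets = allSubsets N
    words = allVecsOf (allFin m) N
    hasα : Vec (Fin m) N → Bool
    hasα u = hasContent (toList u) α

  sign : ℕ → ℤ
  sign c = signPow (c ∸ k ∸ 1)

  signedTerm : Subset N → ℤ
  signedTerm J = if k <ᵇ ∣ J ∣ then sign ∣ J ∣ * (+ fcycCoeff J α) else + 0

  signedTerm-rot : (s : Fin N) (J : Subset N) → signedTerm (rot s J) ≡ signedTerm J
  signedTerm-rot s J = cong₂ (λ c f → if k <ᵇ c then sign c * + f else + 0) (card-rot s J) (fcyc-rot α s J)

  -- The same sign attached to the chains of a subset cut open before position 0.
  pathTerm : Subset N → ℤ
  pathTerm X = if k <ᵇ ∣ X ∣ then sign ∣ X ∣ * E α (Vec.tail X) else + 0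

  signedTerm-unrolled : (J : Subset N) → signedTerm J ≡ Σ (allFin N) (λ k' → pathTerm (rot (predMod k') J))
  signedTerm-unrolled J = begin
    signedTerm J
      ≡⟨ cong (λ z → if k <ᵇ ∣ J ∣ then sign ∣ J ∣ * z else + 0) (fcyc-unrolled α J) ⟩
    (if k <ᵇ ∣ J ∣ then sign ∣ J ∣ * Σ (allFin N) (λ k' → E α (cutAt k' J)) else + 0)
      ≡⟨ sym (Σ-if (allFin N) (k <ᵇ ∣ J ∣) (sign ∣ J ∣) (λ k' → E α (cutAt k' J))) ⟩
    Σ (allFin N) (λ k' → if k <ᵇ ∣ J ∣ then sign ∣ J ∣ * E α (cutAt k' J) else + 0)
      ≡⟨ Σ-cong (allFin N) (λ k' → cong (λ c → if k <ᵇ c then sign c * E α (cutAt k' J) else + 0) (sym (card-rot (predMod k') J))) ⟩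
    Σ (allFin N) (λ k' → pathTerm (rot (predMod k') J)) ∎
    where open ≡-Reasoning

  -- Summing pathTerm over X = 0∷Y and X = 1∷Y telescopes to |Y| = k, and the
  -- k-subsets Y of the ascent set of u are counted by C(asc u, k).
  pathTerms-telescope : Σ subsets pathTerm ≡ ascentSum n k α
  pathTerms-telescope = begin
    Σ subsets pathTerm
      ≡⟨ Σ-subsets-suc pathTerm ⟩
    Σ subs' (λ Y → pathTerm (false Vec.∷ Y)) + Σ subs' (λ Y → pathTerm (true Vec.∷ Y))
      ≡⟨ sym (Σ-+ subs' _ _) ⟩
    Σ subs' (λ Y → pathTerm (false Vec.∷ Y) + pathTerm (true Vec.∷ Y))
      ≡⟨ Σ-cong subs' (λ Y → sign-telescope ∣ Y ∣ k (E α Y)) ⟩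
    Σ subs' (λ Y → ι (∣ Y ∣ ≡ᵇ k) * E α Y)
      ≡⟨ Σ-cong subs' (λ Y → sym (Σ-*ˡ words (ι (∣ Y ∣ ≡ᵇ k)) _)) ⟩
    Σ subs' (λ Y → Σ words (λ u → ι (∣ Y ∣ ≡ᵇ k) * ι (increasingAt u Y ∧ hasα u)))
      ≡⟨ Σ-swap subs' words _ ⟩
    Σ words (λ u → Σ subs' (λ Y → ι (∣ Y ∣ ≡ᵇ k) * ι (increasingAt u Y ∧ hasα u)))
      ≡⟨ Σ-cong words (λ u → Σ-cong subs' (λ Y → regroup u Y)) ⟩
    Σ words (λ u → Σ subs' (λ Y → ι (weaklyIncreasing u ∧ hasα u) * ι ((∣ Y ∣ ≡ᵇ k) ∧ (Y ⊆ᵇ ascents u))))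
      ≡⟨ Σ-cong words (λ u → trans (Σ-*ˡ subs' (ι (weaklyIncreasing u ∧ hasα u)) _)
                                   (cong (ι (weaklyIncreasing u ∧ hasα u) *_) (k-subsets (ascents u) k))) ⟩
    ascentSum n k α ∎
    where
    open ≡-Reasoning
    subs' = allSubsets n
    regroup : ∀ u Y → ι (∣ Y ∣ ≡ᵇ k) * ι (increasingAt u Y ∧ hasα u)
                    ≡ ι (weaklyIncreasing u ∧ hasα u) * ι ((∣ Y ∣ ≡ᵇ k) ∧ (Y ⊆ᵇ ascents u))
    regroup u Y = trans (cong (λ z → ι (∣ Y ∣ ≡ᵇ k) * ι (z ∧ hasα u)) (increasingAt-split u Y))
                        (ι-regroup (∣ Y ∣ ≡ᵇ k) (weaklyIncreasing u) (Y ⊆ᵇ ascents u) (hasα u))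

  rhsSubsets-ascents : rhsSubsets N k α ≡ + N * ascentSum n k α
  rhsSubsets-ascents = begin
    Σ subsets signedTerm
      ≡⟨ Σ-cong subsets signedTerm-unrolled ⟩
    Σ subsets (λ J → Σ (allFin N) (λ k' → pathTerm (rot (predMod k') J)))
      ≡⟨ Σ-swap subsets (allFin N) _ ⟩
    Σ (allFin N) (λ k' → Σ subsets (λ J → pathTerm (rot (predMod k') J)))
      ≡⟨ Σ-cong (allFin N) (λ k' → Σ-rot EnumBool (predMod k') pathTerm) ⟩
    Σ (allFin N) (λ k' → Σ subsets pathTerm)
      ≡⟨ Σ-const N (Σ subsets pathTerm) ⟩
    + N * Σ subsets pathTerm
      ≡⟨ cong (+ N *_) pathTerms-telescope ⟩
    + N * ascentSum n k α ∎
    where open ≡-Reasoning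

countL-++ : {A : Set} (p : A → Bool) (l1 l2 : List A) → countL p (l1 ++ l2) ≡ countL p l1 ℕ.+ countL p l2
countL-++ p [] l2 = refl
countL-++ p (a ∷ l1) l2 = trans (countL-∷ p a (l1 ++ l2)) (trans (cong (bit (p a) ℕ.+_) (countL-++ p l1 l2))
  (trans (sym (ℕP.+-assoc (bit (p a)) _ _)) (cong (ℕ._+ countL p l2) (sym (countL-∷ p a l1)))))

module SortedWords {m : ℕ} where
  private F = Fin m

  cnt : F → List F → ℕ
  cnt i = countL (λ y → y ≡F i)

  cnt-∷ : (i a : F) (l : List F) → cnt i (a ∷ l) ≡ bit (a ≡F i) ℕ.+ cnt i l
  cnt-∷ i = countL-∷ (λ y → y ≡F i)

  cnt-head : (a : F) (l : List F) → 0 < cnt a (a ∷ l)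
  cnt-head a l rewrite cnt-∷ a a l | →≡F {a = a} {b = a} refl = ℕ.s≤s ℕ.z≤n

  cnt-∷-≤ : (i a : F) (l : List F) → cnt i l ≤ cnt i (a ∷ l)
  cnt-∷-≤ i a l = subst (cnt i l ≤_) (sym (cnt-∷ i a l)) (ℕP.m≤n+m (cnt i l) _)

  cnt-∷-pos : (z y : F) (l : List F) → 0 < cnt z l → 0 < cnt z (y ∷ l)
  cnt-∷-pos z y l p = ℕP.<-≤-trans p (cnt-∷-≤ z y l)

  weakInc-tail : (a : F) (l : List F) → weakInc (a ∷ l) ≡ true → weakInc l ≡ true
  weakInc-tail a [] h = refl
  weakInc-tail a (b ∷ l) h = proj₂ (∧-true h)

  head-minimal : (a : F) (l : List F) (x : F) → weakInc (a ∷ l) ≡ true → 0 < cnt x (a ∷ l) → toℕ a ≤ toℕ x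
  head-minimal a l x w p with a ≡F x in e
  ... | true = ℕP.≤-reflexive (cong toℕ (≡F→ e))
  head-minimal a [] x w () | false
  head-minimal a (b ∷ l) x w p | false = ℕP.≤-trans (≤F→ (proj₁ (∧-true w))) (head-minimal b l x (proj₂ (∧-true w)) p)

  weakInc-cons : (y : F) (l : List F) → weakInc l ≡ true → (∀ z → 0 < cnt z l → toℕ y ≤ toℕ z) → weakInc (y ∷ l) ≡ true
  weakInc-cons y [] w h = refl
  weakInc-cons y (z ∷ l) w h = ∧-intro (→≤F (h z (cnt-head z l))) w

  sorted-unique : (l1 l2 : List F) → weakInc l1 ≡ true → weakInc l2 ≡ true → (∀ i → cnt i l1 ≡ cnt i l2) → l1 ≡ l2
  sorted-unique [] [] w1 w2 c = refl
  sorted-unique [] (b ∷ l2) w1 w2 c = ⊥-elim (ℕP.<-irrefl (c b) (cnt-head b l2))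
  sorted-unique (a ∷ l1) [] w1 w2 c = ⊥-elim (ℕP.<-irrefl (sym (c a)) (cnt-head a l1))
  sorted-unique (a ∷ l1) (b ∷ l2) w1 w2 c = cong₂ _∷_ a≡b
    (sorted-unique l1 l2 (weakInc-tail a l1 w1) (weakInc-tail b l2 w2) tails)
    where
    a≡b : a ≡ b
    a≡b = FinP.toℕ-injective (ℕP.≤-antisym
      (head-minimal a l1 b w1 (subst (0 <_) (sym (c b)) (cnt-head b l2)))
      (head-minimal b l2 a w2 (subst (0 <_) (c a) (cnt-head a l1))))
    tails : ∀ i → cnt i l1 ≡ cnt i l2
    tails i = ℕP.+-cancelˡ-≡ (bit (a ≡F i)) _ _ (trans (sym (cnt-∷ i a l1))
      (trans (c i) (trans (cnt-∷ i b l2) (cong (λ z → bit (z ≡F i) ℕ.+ cnt i l2) (sym a≡b)))))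

  ins : F → List F → List F
  ins x [] = x ∷ []
  ins x (y ∷ l) = if x ≤F y then x ∷ y ∷ l else y ∷ ins x l

  ins-cnt : (i x : F) (l : List F) → cnt i (ins x l) ≡ cnt i (x ∷ l)
  ins-cnt i x [] = refl
  ins-cnt i x (y ∷ l) with x ≤F y
  ... | true = refl
  ... | false = begin
    cnt i (y ∷ ins x l)                          ≡⟨ cnt-∷ i y (ins x l) ⟩
    bit (y ≡F i) ℕ.+ cnt i (ins x l)             ≡⟨ cong (bit (y ≡F i) ℕ.+_) (trans (ins-cnt i x l) (cnt-∷ i x l)) ⟩
    bit (y ≡F i) ℕ.+ (bit (x ≡F i) ℕ.+ cnt i l) ≡⟨ ℕ-x∙yz≈y∙xz (bit (y ≡F i)) (bit (x ≡F i)) (cnt i l) ⟩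
    bit (x ≡F i) ℕ.+ (bit (y ≡F i) ℕ.+ cnt i l) ≡⟨ cong (bit (x ≡F i) ℕ.+_) (sym (cnt-∷ i y l)) ⟩
    bit (x ≡F i) ℕ.+ cnt i (y ∷ l)               ≡⟨ sym (cnt-∷ i x (y ∷ l)) ⟩
    cnt i (x ∷ y ∷ l) ∎
    where open ≡-Reasoning

  ins-length : (x : F) (l : List F) → List.length (ins x l) ≡ suc (List.length l)
  ins-length x [] = refl
  ins-length x (y ∷ l) with x ≤F y
  ... | true = refl
  ... | false = cong suc (ins-length x l)

  ins-sorted : (x : F) (l : List F) → weakInc l ≡ true → weakInc (ins x l) ≡ true
  ins-sorted x [] w = refl
  ins-sorted x (y ∷ l) w with x ≤F y in x≤y
  ... | true = ∧-intro x≤y w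
  ... | false = weakInc-cons y (ins x l) (ins-sorted x l (weakInc-tail y l w)) y-below
    where
    y≤x : toℕ y ≤ toℕ x
    y≤x = ℕP.<⇒≤ (ℕP.≰⇒> (λ h → true≢false (trans (sym (→≤F h)) x≤y)))
    y-below : ∀ z → 0 < cnt z (ins x l) → toℕ y ≤ toℕ z
    y-below z p with x ≡F z in x≡z
    ... | true = subst (λ q → toℕ y ≤ toℕ q) (≡F→ x≡z) y≤x
    ... | false = head-minimal y l z w (cnt-∷-pos z y l (subst (0 <_)
                    (trans (ins-cnt z x l) (trans (cnt-∷ z x l) (cong (λ b → bit b ℕ.+ cnt z l) x≡z))) p))

  sort : List F → List F
  sort [] = []
  sort (x ∷ l) = ins x (sort l)

  sort-sorted : (l : List F) → weakInc (sort l) ≡ true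
  sort-sorted [] = refl
  sort-sorted (x ∷ l) = ins-sorted x (sort l) (sort-sorted l)

  sort-cnt : (i : F) (l : List F) → cnt i (sort l) ≡ cnt i l
  sort-cnt i [] = refl
  sort-cnt i (x ∷ l) = trans (ins-cnt i x (sort l))
    (trans (cnt-∷ i x (sort l)) (trans (cong (bit (x ≡F i) ℕ.+_) (sort-cnt i l)) (sym (cnt-∷ i x l))))

  sort-length : (l : List F) → List.length (sort l) ≡ List.length l
  sort-length [] = refl
  sort-length (x ∷ l) = trans (ins-length x (sort l)) (cong suc (sort-length l))

  remove : F → List F → List F
  remove x [] = []
  remove x (y ∷ l) = if y ≡F x then l else y ∷ remove x l

  remove-cnt : (i x : F) (l : List F) → 0 < cnt x l → cnt i (remove x l) ℕ.+ bit (x ≡F i) ≡ cnt i l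
  remove-cnt i x (y ∷ l) p with y ≡F x in y≡x
  ... | true = trans (ℕP.+-comm (cnt i l) _)
                     (sym (trans (cnt-∷ i y l) (cong (λ z → bit (z ≡F i) ℕ.+ cnt i l) (≡F→ {a = y} {b = x} y≡x))))
  ... | false = begin
    cnt i (y ∷ remove x l) ℕ.+ bit (x ≡F i)              ≡⟨ cong (ℕ._+ bit (x ≡F i)) (cnt-∷ i y (remove x l)) ⟩
    bit (y ≡F i) ℕ.+ cnt i (remove x l) ℕ.+ bit (x ≡F i) ≡⟨ ℕP.+-assoc (bit (y ≡F i)) _ _ ⟩
    bit (y ≡F i) ℕ.+ (cnt i (remove x l) ℕ.+ bit (x ≡F i)) ≡⟨ cong (bit (y ≡F i) ℕ.+_) (remove-cnt i x l p) ⟩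
    bit (y ≡F i) ℕ.+ cnt i l                              ≡⟨ sym (cnt-∷ i y l) ⟩
    cnt i (y ∷ l) ∎
    where open ≡-Reasoning

  remove-length : (x : F) (l : List F) → 0 < cnt x l → suc (List.length (remove x l)) ≡ List.length l
  remove-length x (y ∷ l) p with y ≡F x
  ... | true = refl
  ... | false = cong suc (remove-length x l p)

  remove-cnt-≤ : (i x : F) (l : List F) → cnt i (remove x l) ≤ cnt i l
  remove-cnt-≤ i x [] = ℕ.z≤n
  remove-cnt-≤ i x (y ∷ l) with y ≡F x
  ... | true = cnt-∷-≤ i y l
  ... | false = subst₂ _≤_ (sym (cnt-∷ i y (remove x l))) (sym (cnt-∷ i y l))
                       (ℕP.+-monoʳ-≤ (bit (y ≡F i)) (remove-cnt-≤ i x l))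

  remove-sorted : (x : F) (l : List F) → weakInc l ≡ true → weakInc (remove x l) ≡ true
  remove-sorted x [] w = refl
  remove-sorted x (y ∷ l) w with y ≡F x
  ... | true = weakInc-tail y l w
  ... | false = weakInc-cons y (remove x l) (remove-sorted x l (weakInc-tail y l w))
     (λ z p → head-minimal y l z w (cnt-∷-pos z y l (ℕP.<-≤-trans p (remove-cnt-≤ z x l))))

  removeAll : List F → List F → List F
  removeAll [] s = s
  removeAll (c ∷ cs) s = remove c (removeAll cs s)

  removeAll-sorted : (cs s : List F) → weakInc s ≡ true → weakInc (removeAll cs s) ≡ true
  removeAll-sorted [] s w = w
  removeAll-sorted (c ∷ cs) s w = remove-sorted c (removeAll cs s) (removeAll-sorted cs s w)

  removeAll-cnt : (cs s : List F) → (∀ i → cnt i cs ≤ cnt i s) → ∀ i → cnt i (removeAll cs s) ℕ.+ cnt i cs ≡ cnt i s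

  removeAll-next : (c : F) (cs s : List F) → (∀ i → cnt i (c ∷ cs) ≤ cnt i s) → 0 < cnt c (removeAll cs s)
  removeAll-next c cs s sub = ℕP.+-cancelʳ-< (cnt c cs) 0 (cnt c (removeAll cs s)) (begin-strict
    cnt c cs                                  <⟨ subst (cnt c cs <_) (sym c-once) (ℕP.n<1+n _) ⟩
    cnt c (c ∷ cs)                            ≤⟨ sub c ⟩
    cnt c s                                   ≡⟨ sym (removeAll-cnt cs s (λ i → ℕP.≤-trans (cnt-∷-≤ i c cs) (sub i)) c) ⟩
    cnt c (removeAll cs s) ℕ.+ cnt c cs ∎)
    where
    open ℕP.≤-Reasoning
    c-once : cnt c (c ∷ cs) ≡ suc (cnt c cs)
    c-once = trans (cnt-∷ c c cs) (cong (λ b → bit b ℕ.+ cnt c cs) (→≡F {a = c} {b = c} refl))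

  removeAll-cnt [] s h i = ℕP.+-identityʳ (cnt i s)
  removeAll-cnt (c ∷ cs) s sub i = begin
    cnt i (remove c t) ℕ.+ cnt i (c ∷ cs)                 ≡⟨ cong (cnt i (remove c t) ℕ.+_) (cnt-∷ i c cs) ⟩
    cnt i (remove c t) ℕ.+ (bit (c ≡F i) ℕ.+ cnt i cs)    ≡⟨ sym (ℕP.+-assoc (cnt i (remove c t)) _ _) ⟩
    cnt i (remove c t) ℕ.+ bit (c ≡F i) ℕ.+ cnt i cs      ≡⟨ cong (ℕ._+ cnt i cs) (remove-cnt i c t (removeAll-next c cs s sub)) ⟩
    cnt i t ℕ.+ cnt i cs                                  ≡⟨ removeAll-cnt cs s (λ j → ℕP.≤-trans (cnt-∷-≤ j c cs) (sub j)) i ⟩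
    cnt i s ∎
    where
    open ≡-Reasoning
    t = removeAll cs s

  removeAll-length : (cs s : List F) → (∀ i → cnt i cs ≤ cnt i s) →
    List.length (removeAll cs s) ℕ.+ List.length cs ≡ List.length s
  removeAll-length [] s h = ℕP.+-identityʳ _
  removeAll-length (c ∷ cs) s sub = trans (ℕP.+-suc (List.length (remove c t)) _)
    (trans (cong (ℕ._+ List.length cs) (remove-length c t (removeAll-next c cs s sub)))
           (removeAll-length cs s (λ i → ℕP.≤-trans (cnt-∷-≤ i c cs) (sub i))))
    where t = removeAll cs s

module Ascents {m : ℕ} where
  open SortedWords {m}
  private F = Fin m

  ascentsL : F → List F → ℕ
  ascentsL a [] = 0
  ascentsL a (b ∷ l) = bit (a <F b) ℕ.+ ascentsL b l

  occursIn : F → List F → Bool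
  occursIn y l = 0 <ᵇ cnt y l

  occursIn→ : (y : F) (l : List F) → occursIn y l ≡ true → 0 < cnt y l
  occursIn→ y l h = ℕP.<ᵇ⇒< 0 (cnt y l) (≡→T h)

  →occursIn : (y : F) (l : List F) → 0 < cnt y l → occursIn y l ≡ true
  →occursIn y l h = T→≡ (ℕP.<⇒<ᵇ h)

  occursIn-tail : (y a : F) (l : List F) → ¬ a ≡ y → occursIn y (a ∷ l) ≡ true → occursIn y l ≡ true
  occursIn-tail y a l a≢y h = →occursIn y l (subst (0 <_) (trans (cnt-∷ y a l) (cong (λ b → bit b ℕ.+ cnt y l) (≢→≡F a≢y))) (occursIn→ y (a ∷ l) h))

  occursIn-∷ : (y a : F) (l : List F) → occursIn y l ≡ true → occursIn y (a ∷ l) ≡ true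
  occursIn-∷ y a l h = →occursIn y (a ∷ l) (cnt-∷-pos y a l (occursIn→ y l h))

  countFin-singleton : (b : F) → countFin (λ y → b ≡F y) ≡ 1
  countFin-singleton b = +-inj (trans (countL-Σ (λ y → b ≡F y) (allFin m))
    (trans (Σ-unique (EnumFin m) (λ y → b ≡F y) b (λ x e → sym (≡F→ {a = b} {b = x} e))) (cong ι (→≡F {a = b} {b = b} refl))))

  above-step : (a b : F) (l : List F) → weakInc (b ∷ l) ≡ true → toℕ a < toℕ b → ∀ y →
    ((a <F y) ∧ occursIn y (a ∷ b ∷ l)) ≡ ((b ≡F y) ∨ ((b <F y) ∧ occursIn y (b ∷ l)))
  above-step a b l sorted a<b y = bool-ext to from
    where
    to : ((a <F y) ∧ occursIn y (a ∷ b ∷ l)) ≡ true → ((b ≡F y) ∨ ((b <F y) ∧ occursIn y (b ∷ l))) ≡ true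
    to h with ∧-true {a <F y} {occursIn y (a ∷ b ∷ l)} h | b FinP.≟ y
    ... | _ | yes b≡y = ∨-introˡ (→≡F b≡y)
    ... | a<y , occ | no b≢y = ∨-introʳ {b ≡F y} (∧-intro {b <F y} {occursIn y (b ∷ l)} (→<F {a = b} {b = y} b<y) occ-tail)
      where
      occ-tail = occursIn-tail y a (b ∷ l) (λ q → ℕP.<-irrefl (cong toℕ q) (<F→ {a = a} {b = y} a<y)) occ
      b<y : toℕ b < toℕ y
      b<y = ℕP.≤∧≢⇒< (head-minimal b l y sorted (occursIn→ y (b ∷ l) occ-tail)) (λ q → b≢y (FinP.toℕ-injective q))
    from : ((b ≡F y) ∨ ((b <F y) ∧ occursIn y (b ∷ l))) ≡ true → ((a <F y) ∧ occursIn y (a ∷ b ∷ l)) ≡ true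
    from h with b FinP.≟ y
    ... | yes refl = ∧-intro {a <F b} {occursIn b (a ∷ b ∷ l)} (→<F {a = a} {b = b} a<b)
                       (occursIn-∷ b a (b ∷ l) (→occursIn b (b ∷ l) (cnt-head b l)))
    ... | no b≢y with ∧-true {b <F y} {occursIn y (b ∷ l)} (∨-elimʳ {b ≡F y} h (≢→≡F b≢y))
    ... | b<y , occ = ∧-intro {a <F y} {occursIn y (a ∷ b ∷ l)}
                        (→<F {a = a} {b = y} (ℕP.<-trans a<b (<F→ {a = b} {b = y} b<y))) (occursIn-∷ y a (b ∷ l) occ)

  above-repeat : (a : F) (l : List F) → ∀ y →
    ((a <F y) ∧ occursIn y (a ∷ a ∷ l)) ≡ ((a <F y) ∧ occursIn y (a ∷ l))
  above-repeat a l y = bool-ext to from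
    where
    to : ((a <F y) ∧ occursIn y (a ∷ a ∷ l)) ≡ true → ((a <F y) ∧ occursIn y (a ∷ l)) ≡ true
    to h with ∧-true {a <F y} {occursIn y (a ∷ a ∷ l)} h
    ... | a<y , occ = ∧-intro {a <F y} {occursIn y (a ∷ l)} a<y
                        (occursIn-tail y a (a ∷ l) (λ q → ℕP.<-irrefl (cong toℕ q) (<F→ {a = a} {b = y} a<y)) occ)
    from : ((a <F y) ∧ occursIn y (a ∷ l)) ≡ true → ((a <F y) ∧ occursIn y (a ∷ a ∷ l)) ≡ true
    from h with ∧-true {a <F y} {occursIn y (a ∷ l)} h
    ... | a<y , occ = ∧-intro {a <F y} {occursIn y (a ∷ a ∷ l)} a<y (occursIn-∷ y a (a ∷ l) occ)

  distinct-above-head : (a : F) (l : List F) → weakInc (a ∷ l) ≡ true →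
    countFin (λ y → (a <F y) ∧ occursIn y (a ∷ l)) ≡ ascentsL a l
  distinct-above-head a [] w = trans (countL-cong (allFin m) nothing-above) (countL-false (allFin m))
    where
    nothing-above : ∀ y → ((a <F y) ∧ occursIn y (a ∷ [])) ≡ false
    nothing-above y with a ≡F y in a≡y
    ... | true rewrite sym (≡F→ {a = a} {b = y} a≡y) = trans (BoolP.∧-identityʳ (a <F a)) (≮→<F {a = a} {b = a} (ℕP.<-irrefl refl))
    ... | false = BoolP.∧-zeroʳ (a <F y)
  distinct-above-head a (b ∷ l) w with a <F b in a<b
  ... | true = trans (countL-cong (allFin m) (above-step a b l wb (<F→ {a = a} {b = b} a<b)))
      (trans (countL-∨ (allFin m) (λ y → b ≡F y) (λ y → (b <F y) ∧ occursIn y (b ∷ l)) disjoint)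
             (cong₂ ℕ._+_ (countFin-singleton b) (distinct-above-head b l wb)))
    where
    wb = weakInc-tail a (b ∷ l) w
    disjoint : ∀ y → (b ≡F y) ∧ ((b <F y) ∧ occursIn y (b ∷ l)) ≡ false
    disjoint y with b ≡F y in b≡y
    ... | true rewrite sym (≡F→ {a = b} {b = y} b≡y) | ≮→<F {a = b} {b = b} (ℕP.<-irrefl refl) = refl
    ... | false = refl
  ... | false = trans (countL-cong (allFin m) (λ y → subst (λ z → ((a <F y) ∧ occursIn y (a ∷ z ∷ l)) ≡ ((z <F y) ∧ occursIn y (z ∷ l))) a≡b (above-repeat a l y)))
                      (distinct-above-head b l wb)
    where
    wb = weakInc-tail a (b ∷ l) w
    a≡b : a ≡ b
    a≡b = FinP.toℕ-injective (ℕP.≤-antisym (≤F→ {a = a} {b = b} (proj₁ (∧-true {a ≤F b} {weakInc (b ∷ l)} w)))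
                                           (ℕP.≮⇒≥ (λ q → true≢false (trans (sym (→<F {a = a} {b = b} q)) a<b))))

-- (A) Hook tableaux

-- Choosing a strictly increasing sequence of k+1 letters from U: choose the
-- first letter x, then k letters of U above x.
increasing-choices : {m : ℕ} (U : Fin m → Bool) (k : ℕ) →
  Σ (allFin m) (λ x → ι (U x) * + (countFin (λ y → U y ∧ (x <F y)) C k)) ≡ + (countFin U C suc k)
increasing-choices {zero} U k = cong +_ (sym (0C[1+k]≡0 k))
increasing-choices {suc m} U k = begin
  Σ (allFin (suc m)) (λ x → ι (U x) * + (countFin (λ y → U y ∧ (x <F y)) C k))
    ≡⟨ Σ-allFin-suc (λ x → ι (U x) * + (countFin (λ y → U y ∧ (x <F y)) C k)) ⟩
  ι (U₀) * + (countFin (λ y → U y ∧ (Fin.zero <F y)) C k)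
    + Σ (allFin m) (λ x → ι (U' x) * + (countFin (λ y → U y ∧ (Fin.suc x <F y)) C k))
    ≡⟨ cong₂ _+_ (cong (λ z → ι U₀ * + (z C k)) above-zero)
                 (Σ-cong (allFin m) (λ x → cong (λ z → ι (U' x) * + (z C k)) (above-suc x))) ⟩
  ι U₀ * + (countFin U' C k) + Σ (allFin m) (λ x → ι (U' x) * + (countFin (λ y → U' y ∧ (x <F y)) C k))
    ≡⟨ cong (λ z → ι U₀ * + (countFin U' C k) + z) (increasing-choices U' k) ⟩
  ι U₀ * + (countFin U' C k) + + (countFin U' C suc k)
    ≡⟨ pascal U₀ ⟩
  + ((bit U₀ ℕ.+ countFin U') C suc k)
    ≡⟨ cong (λ z → + (z C suc k)) (sym (countFin-suc U)) ⟩
  + (countFin U C suc k) ∎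
  where
  open ≡-Reasoning
  U₀ = U Fin.zero
  U' : Fin m → Bool
  U' i = U (Fin.suc i)
  above-zero : countFin (λ y → U y ∧ (Fin.zero <F y)) ≡ countFin U'
  above-zero = trans (countFin-suc (λ y → U y ∧ (Fin.zero <F y)))
    (cong₂ ℕ._+_ (cong bit (BoolP.∧-zeroʳ U₀)) (countL-cong (allFin m) (λ y → BoolP.∧-identityʳ (U' y))))
  above-suc : (x : Fin m) → countFin (λ y → U y ∧ (Fin.suc x <F y)) ≡ countFin (λ y → U' y ∧ (x <F y))
  above-suc x = trans (countFin-suc (λ y → U y ∧ (Fin.suc x <F y)))
    (cong (λ b → bit b ℕ.+ countFin (λ y → U' y ∧ (x <F y))) (BoolP.∧-zeroʳ U₀))
  pascal : (b : Bool) → ι b * + (countFin U' C k) + + (countFin U' C suc k) ≡ + ((bit b ℕ.+ countFin U') C suc k)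
  pascal true = trans (cong (_+ + (countFin U' C suc k)) (ℤP.*-identityˡ (+ (countFin U' C k))))
                      (cong +_ (nCk+nC[k+1]≡[n+1]C[k+1] (countFin U') k))
  pascal false = trans (cong (_+ + (countFin U' C suc k)) (ℤP.*-zeroˡ (+ (countFin U' C k)))) (ℤP.+-identityˡ _)

toVec : {A : Set} (l : List A) (L : ℕ) → List.length l ≡ L → Σ[ v ∈ Vec A L ] toList v ≡ l
toVec [] zero e = Vec.[] , refl
toVec (x ∷ l) (suc L) e with toVec l L (ℕP.suc-injective e)
... | v , p = (x Vec.∷ v) , cong (x ∷_) p

toList-injective : {A : Set} {n : ℕ} (v w : Vec A n) → toList v ≡ toList w → v ≡ w
toList-injective Vec.[] Vec.[] e = refl
toList-injective (x Vec.∷ v) (y Vec.∷ w) e =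
  cong₂ Vec._∷_ (ListP.∷-injectiveˡ e) (toList-injective v w (ListP.∷-injectiveʳ e))

module HookShape {m : ℕ} (α : Fin m → ℕ) where
  open SortedWords {m}
  open Ascents {m}
  private F = Fin m

  strictInc : List F → Bool
  strictInc [] = true
  strictInc (c ∷ []) = true
  strictInc (c ∷ d ∷ ds) = (c <F d) ∧ strictInc (d ∷ ds)

  strictInc-head : (a b : F) (l : List F) → strictInc (a ∷ b ∷ l) ≡ true → toℕ a < toℕ b
  strictInc-head a b l p = <F→ {a = a} {b = b} (proj₁ (∧-true {a <F b} {strictInc (b ∷ l)} p))

  strictInc-tail : (a b : F) (l : List F) → strictInc (a ∷ b ∷ l) ≡ true → strictInc (b ∷ l) ≡ true
  strictInc-tail a b l p = proj₂ (∧-true {a <F b} {strictInc (b ∷ l)} p)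

  strictInc-lower : (h r0 : F) (cs : List F) → toℕ h ≤ toℕ r0 → strictInc (r0 ∷ cs) ≡ true → strictInc (h ∷ cs) ≡ true
  strictInc-lower h r0 [] le st = refl
  strictInc-lower h r0 (c ∷ cs) le st = ∧-intro {h <F c} {strictInc (c ∷ cs)}
    (→<F {a = h} {b = c} (ℕP.≤-<-trans le (strictInc-head r0 c cs st))) (strictInc-tail r0 c cs st)

  content→cnt : (l : List F) → hasContent l α ≡ true → ∀ i → cnt i l ≡ α i
  content→cnt l h i = ℕP.≡ᵇ⇒≡ _ _ (≡→T (allB→ (λ i → cnt i l ≡ᵇ α i) h i))

  cnt→content : (l : List F) → (∀ i → cnt i l ≡ α i) → hasContent l α ≡ true
  cnt→content l h = →allB (λ i → cnt i l ≡ᵇ α i) (λ i → T→≡ (ℕP.≡⇒≡ᵇ _ _ (h i)))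

  -- A tableau of shape (L+1, 1^k) is its first row r0 ∷ rr together with the
  -- leg cs below r0, stored as a column of singleton rows.
  column : List F → List (List F)
  column = map (_∷ [])

  concat-column : (cs : List F) → List.concat (column cs) ≡ cs
  concat-column [] = refl
  concat-column (c ∷ cs) = cong (c ∷_) (concat-column cs)

  tableauOK : List (List F) → Bool
  tableauOK T = isSSYT T ∧ hasContent (List.concat T) α

  hookOK : F → List F → List F → Bool
  hookOK r0 rr cs = (weakInc (r0 ∷ rr) ∧ strictInc (r0 ∷ cs)) ∧ hasContent ((r0 ∷ rr) ++ cs) α

  tableauOK-hook : (r0 : F) (rr cs : List F) → tableauOK ((r0 ∷ rr) ∷ column cs) ≡ hookOK r0 rr cs
  tableauOK-hook r0 rr cs = cong₂ _∧_ (isSSYT-hook cs) (cong (λ z → hasContent ((r0 ∷ rr) ++ z) α) (concat-column cs))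
    where
    colStrict-[] : (l : List F) → colStrict l [] ≡ true
    colStrict-[] [] = refl
    colStrict-[] (x ∷ l) = refl
    isSSYT-column : (c : F) (cs : List F) → isSSYT ((c ∷ []) ∷ column cs) ≡ strictInc (c ∷ cs)
    isSSYT-column c [] = refl
    isSSYT-column c (d ∷ ds) = cong₂ _∧_ (BoolP.∧-identityʳ (c <F d)) (isSSYT-column d ds)
    isSSYT-hook : (cs : List F) → isSSYT ((r0 ∷ rr) ∷ column cs) ≡ weakInc (r0 ∷ rr) ∧ strictInc (r0 ∷ cs)
    isSSYT-hook [] = sym (BoolP.∧-identityʳ _)
    isSSYT-hook (c ∷ cs) = cong (weakInc (r0 ∷ rr) ∧_)
      (cong₂ _∧_ (trans (cong ((r0 <F c) ∧_) (colStrict-[] rr)) (BoolP.∧-identityʳ (r0 <F c))) (isSSYT-column c cs))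

  module _ {r0 : F} {rr cs : List F} (ok : hookOK r0 rr cs ≡ true) where
    hookOK-row : weakInc (r0 ∷ rr) ≡ true
    hookOK-row = proj₁ (∧-true {weakInc (r0 ∷ rr)} {strictInc (r0 ∷ cs)}
      (proj₁ (∧-true {weakInc (r0 ∷ rr) ∧ strictInc (r0 ∷ cs)} {hasContent ((r0 ∷ rr) ++ cs) α} ok)))
    hookOK-leg : strictInc (r0 ∷ cs) ≡ true
    hookOK-leg = proj₂ (∧-true {weakInc (r0 ∷ rr)} {strictInc (r0 ∷ cs)}
      (proj₁ (∧-true {weakInc (r0 ∷ rr) ∧ strictInc (r0 ∷ cs)} {hasContent ((r0 ∷ rr) ++ cs) α} ok)))
    hookOK-content : ∀ i → cnt i (r0 ∷ rr) ℕ.+ cnt i cs ≡ α i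
    hookOK-content i = trans (sym (countL-++ (λ y → y ≡F i) (r0 ∷ rr) cs)) (content→cnt ((r0 ∷ rr) ++ cs)
      (proj₂ (∧-true {weakInc (r0 ∷ rr) ∧ strictInc (r0 ∷ cs)} {hasContent ((r0 ∷ rr) ++ cs) α} ok)) i)

  mkHookOK : (r0 : F) (rr cs : List F) → weakInc (r0 ∷ rr) ≡ true → strictInc (r0 ∷ cs) ≡ true →
    (∀ i → cnt i (r0 ∷ rr) ℕ.+ cnt i cs ≡ α i) → hookOK r0 rr cs ≡ true
  mkHookOK r0 rr cs row leg content =
    ∧-intro {weakInc (r0 ∷ rr) ∧ strictInc (r0 ∷ cs)} {hasContent ((r0 ∷ rr) ++ cs) α}
      (∧-intro {weakInc (r0 ∷ rr)} {strictInc (r0 ∷ cs)} row leg)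
      (cnt→content ((r0 ∷ rr) ++ cs) (λ i → trans (countL-++ (λ y → y ≡F i) (r0 ∷ rr) cs) (content i)))

  hookOK-unique : (a b : F) (ra rb cs : List F) → hookOK a ra cs ≡ true → hookOK b rb cs ≡ true → a ∷ ra ≡ b ∷ rb
  hookOK-unique a b ra rb cs pa pb = sorted-unique (a ∷ ra) (b ∷ rb) (hookOK-row {a} {ra} {cs} pa) (hookOK-row {b} {rb} {cs} pb)
    (λ i → ℕP.+-cancelʳ-≡ (cnt i cs) _ _ (trans (hookOK-content {a} {ra} {cs} pa i) (sym (hookOK-content {b} {rb} {cs} pb i))))

  allB-members : (p : F → Bool) (cs : List F) → (∀ c → 0 < cnt c cs → p c ≡ true) → allB p cs ≡ true
  allB-members p [] h = refl
  allB-members p (c ∷ cs) h = ∧-intro {p c} {allB p cs} (h c (cnt-head c cs)) (allB-members p cs (λ d q → h d (cnt-∷-pos d c cs q)))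

  module Legs (h : F) (s' : List F) (sorted : weakInc (h ∷ s') ≡ true) (s-content : ∀ i → cnt i (h ∷ s') ≡ α i) where
    s = h ∷ s'

    occurs : F → Bool
    occurs c = 0 <ᵇ cnt c s

    legOK : F → List F → Bool
    legOK lo cs = strictInc (lo ∷ cs) ∧ allB occurs cs

    legOK-∷ : (lo x : F) (cs : List F) → legOK lo (x ∷ cs) ≡ ((lo <F x) ∧ occurs x) ∧ legOK x cs
    legOK-∷ lo x cs = ∧-interchange (lo <F x) (strictInc (x ∷ cs)) (occurs x) (allB occurs cs)

    hook→legOK : (r0 : F) (rr cs : List F) → hookOK r0 rr cs ≡ true → legOK h cs ≡ true
    hook→legOK r0 rr cs ok = ∧-intro {strictInc (h ∷ cs)} {allB occurs cs}
      (strictInc-lower h r0 cs h≤r0 (hookOK-leg {r0} {rr} {cs} ok)) (allB-members occurs cs member)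
      where
      split : ∀ i → cnt i (r0 ∷ rr) ℕ.+ cnt i cs ≡ cnt i s
      split i = trans (hookOK-content {r0} {rr} {cs} ok i) (sym (s-content i))
      h≤r0 : toℕ h ≤ toℕ r0
      h≤r0 = head-minimal h s' r0 sorted (subst (0 <_) (split r0) (ℕP.<-≤-trans (cnt-head r0 rr) (ℕP.m≤m+n _ _)))
      member : ∀ c → 0 < cnt c cs → occurs c ≡ true
      member c q = T→≡ (ℕP.<⇒<ᵇ (subst (0 <_) (split c) (ℕP.<-≤-trans q (ℕP.m≤n+m _ _))))

    leg-bounds : (lo : F) (cs : List F) → legOK lo cs ≡ true →
      ∀ i → (cnt i cs ≤ cnt i s) × (toℕ i ≤ toℕ lo → cnt i cs ≡ 0)
    leg-bounds lo [] ok i = ℕ.z≤n , (λ _ → refl)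
    leg-bounds lo (c ∷ cs) ok i with ∧-true {strictInc (lo ∷ c ∷ cs)} {allB occurs (c ∷ cs)} ok
    ... | st , occ with ∧-true {occurs c} {allB occurs cs} occ
    ... | occ-c , occ-cs with leg-bounds c cs (∧-intro {strictInc (c ∷ cs)} {allB occurs cs} (strictInc-tail lo c cs st) occ-cs) i | c ≡F i in c≡i
    ... | sub , avoid | true = subst (_≤ cnt i s) (sym (cong suc (avoid (ℕP.≤-reflexive (cong toℕ (sym (≡F→ c≡i))))))) i-occurs ,
          (λ i≤lo → ⊥-elim (ℕP.<-irrefl refl (ℕP.<-≤-trans (strictInc-head lo c cs st) (subst (λ z → toℕ z ≤ toℕ lo) (sym (≡F→ c≡i)) i≤lo))))
      where
      i-occurs : 1 ≤ cnt i s
      i-occurs = subst (λ z → 1 ≤ cnt z s) (≡F→ c≡i) (ℕP.<ᵇ⇒< 0 (cnt c s) (≡→T occ-c))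
    ... | sub , avoid | false = sub , (λ i≤lo → avoid (ℕP.≤-trans i≤lo (ℕP.<⇒≤ (strictInc-head lo c cs st))))

    -- Conversely every leg below h is the leg of a hook tableau: the first row
    -- is what remains of s after removing the leg, and it starts with h.
    arm-exists : (L : ℕ) (cs : List F) → List.length s ≡ suc L ℕ.+ List.length cs → legOK h cs ≡ true →
      Σ[ arm ∈ Vec F L ] hookOK h (toList arm) cs ≡ true
    arm-exists L cs len ok = build (removeAll cs s) refl
      where
      leg = proj₁ (∧-true {strictInc (h ∷ cs)} {allB occurs cs} ok)
      sub : ∀ i → cnt i cs ≤ cnt i s
      sub i = proj₁ (leg-bounds h cs ok i)
      rest-length : List.length (removeAll cs s) ℕ.+ List.length cs ≡ suc L ℕ.+ List.length cs
      rest-length = trans (removeAll-length cs s sub) len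
      build : (r : List F) → removeAll cs s ≡ r → Σ[ arm ∈ Vec F L ] hookOK h (toList arm) cs ≡ true
      build [] e = ⊥-elim (ℕP.0≢1+n (ℕP.+-cancelʳ-≡ (List.length cs) 0 (suc L)
                     (trans (cong (λ z → List.length z ℕ.+ List.length cs) (sym e)) rest-length)))
      build (r0 ∷ rr) e = arm , ok'
        where
        row : weakInc (r0 ∷ rr) ≡ true
        row = subst (λ z → weakInc z ≡ true) e (removeAll-sorted cs s sorted)
        split : ∀ i → cnt i (r0 ∷ rr) ℕ.+ cnt i cs ≡ cnt i s
        split i = subst (λ z → cnt i z ℕ.+ cnt i cs ≡ cnt i s) e (removeAll-cnt cs s sub i)
        r0≤h : toℕ r0 ≤ toℕ h
        r0≤h = head-minimal r0 rr h row (subst (0 <_)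
          (trans (sym (split h)) (trans (cong (cnt h (r0 ∷ rr) ℕ.+_) (proj₂ (leg-bounds h cs ok h) ℕP.≤-refl)) (ℕP.+-identityʳ _)))
          (cnt-head h s'))
        h≤r0 : toℕ h ≤ toℕ r0
        h≤r0 = head-minimal h s' r0 sorted (subst (0 <_) (split r0) (ℕP.<-≤-trans (cnt-head r0 rr) (ℕP.m≤m+n _ _)))
        r0≡h : r0 ≡ h
        r0≡h = FinP.toℕ-injective (ℕP.≤-antisym r0≤h h≤r0)
        rr-length : List.length rr ≡ L
        rr-length = ℕP.suc-injective (ℕP.+-cancelʳ-≡ (List.length cs) _ _
          (trans (cong (λ z → List.length z ℕ.+ List.length cs) (sym e)) rest-length))
        arm = proj₁ (toVec rr L rr-length)
        ok' : hookOK h (toList arm) cs ≡ true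
        ok' rewrite proj₂ (toVec rr L rr-length) | sym r0≡h =
          mkHookOK r0 rr cs row (subst (λ z → strictInc (z ∷ cs) ≡ true) (sym r0≡h) leg) (λ i → trans (split i) (s-content i))

    legs-count : (k : ℕ) (lo : F) →
      Σ (allVecsOf (allFin m) k) (λ v → ι (legOK lo (toList v))) ≡ + (countFin (λ y → (lo <F y) ∧ occurs y) C k)
    legs-count zero lo = refl
    legs-count (suc k) lo = begin
      Σ (allVecsOf (allFin m) (suc k)) (λ v → ι (legOK lo (toList v)))
        ≡⟨ Σ-vecs-suc (allFin m) k (λ v → ι (legOK lo (toList v))) ⟩
      Σ (allFin m) (λ x → Σ (allVecsOf (allFin m) k) (λ v → ι (legOK lo (x ∷ toList v))))
        ≡⟨ Σ-cong (allFin m) (λ x → Σ-cong (allVecsOf (allFin m) k) (λ v →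
             trans (cong ι (legOK-∷ lo x (toList v))) (ι-∧ (U x) (legOK x (toList v))))) ⟩
      Σ (allFin m) (λ x → Σ (allVecsOf (allFin m) k) (λ v → ι (U x) * ι (legOK x (toList v))))
        ≡⟨ Σ-cong (allFin m) (λ x → trans (Σ-*ˡ (allVecsOf (allFin m) k) (ι (U x)) _) (cong (ι (U x) *_) (legs-count k x))) ⟩
      Σ (allFin m) (λ x → ι (U x) * + (countFin (λ y → (x <F y) ∧ occurs y) C k))
        ≡⟨ Σ-cong (allFin m) (λ x → ι-*-cong (U x) (λ Ux → cong (λ z → + (z C k)) (countL-cong (allFin m) (above-x x Ux)))) ⟩
      Σ (allFin m) (λ x → ι (U x) * + (countFin (λ y → U y ∧ (x <F y)) C k))
        ≡⟨ increasing-choices U k ⟩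
      + (countFin U C suc k) ∎
      where
      open ≡-Reasoning
      U : F → Bool
      U y = (lo <F y) ∧ occurs y
      above-x : ∀ x → U x ≡ true → ∀ y → ((x <F y) ∧ occurs y) ≡ (U y ∧ (x <F y))
      above-x x Ux y with x <F y in x<y
      ... | false = sym (BoolP.∧-zeroʳ (U y))
      ... | true rewrite →<F {a = lo} {b = y} (ℕP.<-trans (<F→ {a = lo} {b = x} (proj₁ (∧-true {lo <F x} {occurs x} Ux))) (<F→ {a = x} {b = y} x<y))
                 = sym (BoolP.∧-identityʳ (occurs y))

    arms-for-leg : (L : ℕ) (cs : List F) → List.length s ≡ suc L ℕ.+ List.length cs →
      Σ (allVecsOf (allFin m) (suc L)) (λ r → ι (tableauOK (toList r ∷ column cs))) ≡ ι (legOK h cs)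
    arms-for-leg L cs len with legOK h cs in ok
    ... | true = trans (Σ-unique (EnumVec (EnumFin m) (suc L)) (λ r → tableauOK (toList r ∷ column cs)) (h Vec.∷ arm) unique)
                       (cong ι (trans (tableauOK-hook h (toList arm) cs) arm-ok))
      where
      arm = proj₁ (arm-exists L cs len ok)
      arm-ok = proj₂ (arm-exists L cs len ok)
      unique : ∀ r → tableauOK (toList r ∷ column cs) ≡ true → r ≡ h Vec.∷ arm
      unique (x0 Vec.∷ xv) p = toList-injective (x0 Vec.∷ xv) (h Vec.∷ arm)
        (hookOK-unique x0 h (toList xv) (toList arm) cs (trans (sym (tableauOK-hook x0 (toList xv) cs)) p) arm-ok)
    ... | false = trans (Σ-cong (allVecsOf (allFin m) (suc L)) (λ r → cong ι (no-tableau r))) (Σ-0 (allVecsOf (allFin m) (suc L)))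
      where
      no-tableau : ∀ r → tableauOK (toList r ∷ column cs) ≡ false
      no-tableau (x0 Vec.∷ xv) with tableauOK ((x0 ∷ toList xv) ∷ column cs) in t
      ... | false = refl
      ... | true = ⊥-elim (true≢false (trans (sym (hook→legOK x0 (toList xv) cs (trans (sym (tableauOK-hook x0 (toList xv) cs)) t))) ok))

    hook-tableaux-count : (L k : ℕ) → List.length s ≡ suc L ℕ.+ k →
      Σ (allVecsOf (allFin m) k) (λ v → Σ (allVecsOf (allFin m) (suc L)) (λ r → ι (tableauOK (toList r ∷ column (toList v)))))
      ≡ + (ascentsL h s' C k)
    hook-tableaux-count L k len = begin
      _ ≡⟨ Σ-cong (allVecsOf (allFin m) k) (λ v → arms-for-leg L (toList v)
             (trans len (cong (suc L ℕ.+_) (sym (VecP.length-toList v))))) ⟩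
      _ ≡⟨ legs-count k h ⟩
      _ ≡⟨ cong (λ z → + (z C k)) (distinct-above-head h s' sorted) ⟩
      + (ascentsL h s' C k) ∎
      where open ≡-Reasoning

Σ-column-fillings : {m : ℕ} (k : ℕ) (G : List (List (Fin m)) → ℤ) →
  Σ (fillings (List.replicate k 1)) G ≡ Σ (allVecsOf (allFin m) k) (λ v → G (map (_∷ []) (toList v)))
Σ-column-fillings zero G = refl
Σ-column-fillings {m} (suc k) G = begin
  Σ (fillings (List.replicate (suc k) 1)) G
    ≡⟨ Σ-concatMap (λ r → map (toList r ∷_) (fillings (List.replicate k 1))) (allVecsOf (allFin m) 1) G ⟩
  Σ (allVecsOf (allFin m) 1) (λ r → Σ (map (toList r ∷_) (fillings (List.replicate k 1))) G)
    ≡⟨ Σ-cong (allVecsOf (allFin m) 1) (λ r → trans (Σ-map (toList r ∷_) (fillings (List.replicate k 1)) G)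
                                                     (Σ-column-fillings k (λ C → G (toList r ∷ C)))) ⟩
  Σ (allVecsOf (allFin m) 1) (λ r → Σ (allVecsOf (allFin m) k) (λ v → G (toList r ∷ map (_∷ []) (toList v))))
    ≡⟨ Σ-vecs-suc (allFin m) 0 _ ⟩
  Σ (allFin m) (λ x → Σ (allVecsOf (allFin m) k) (λ v → G ((x ∷ []) ∷ map (_∷ []) (toList v))) + + 0)
    ≡⟨ Σ-cong (allFin m) (λ x → ℤP.+-identityʳ _) ⟩
  Σ (allFin m) (λ x → Σ (allVecsOf (allFin m) k) (λ v → G ((x ∷ []) ∷ map (_∷ []) (toList v))))
    ≡⟨ sym (Σ-vecs-suc (allFin m) k (λ v → G (map (_∷ []) (toList v)))) ⟩
  Σ (allVecsOf (allFin m) (suc k)) (λ v → G (map (_∷ []) (toList v))) ∎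
  where open ≡-Reasoning

module HookSchur {m : ℕ} (α : Fin m → ℕ) where
  open SortedWords {m}
  open Ascents {m}
  open HookShape α
  private F = Fin m

  ascents-∷ : {n : ℕ} (a : F) (v : Vec F n) → ∣ Unrolling.ascents {n} (a Vec.∷ v) ∣ ≡ ascentsL a (toList v)
  ascents-∷ a Vec.[] = refl
  ascents-∷ a (b Vec.∷ v) = trans (card-∷ (a <F b) (Unrolling.ascents (b Vec.∷ v))) (cong (bit (a <F b) ℕ.+_) (ascents-∷ b v))

  weaklyIncreasing-∷ : {n : ℕ} (a : F) (v : Vec F n) → Unrolling.weaklyIncreasing {n} (a Vec.∷ v) ≡ weakInc (a ∷ toList v)
  weaklyIncreasing-∷ a Vec.[] = refl
  weaklyIncreasing-∷ a (b Vec.∷ v) = trans (allB-suc (λ i → lookup (a Vec.∷ b Vec.∷ v) (inject₁ i) ≤F lookup (a Vec.∷ b Vec.∷ v) (Fin.suc i)))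
    (cong ((a ≤F b) ∧_) (weaklyIncreasing-∷ b v))

  sortedWithContent : {N : ℕ} → Vec F N → Bool
  sortedWithContent u = weakInc (toList u) ∧ hasContent (toList u) α

  unique-sorted-word : (N : ℕ) (w : List F) → List.length w ≡ N → hasContent w α ≡ true →
    Σ (allVecsOf (allFin m) N) (λ u → ι (sortedWithContent u)) ≡ + 1
  unique-sorted-word N w len hw = trans (Σ-unique (EnumVec (EnumFin m) N) sortedWithContent u* unique) (cong ι u*-ok)
    where
    sorted-w = toVec (sort w) N (trans (sort-length w) len)
    u* = proj₁ sorted-w
    content* : ∀ i → cnt i (sort w) ≡ α i
    content* i = trans (sort-cnt i w) (content→cnt w hw i)
    u*-ok : sortedWithContent u* ≡ true
    u*-ok rewrite proj₂ sorted-w = ∧-intro {weakInc (sort w)} {hasContent (sort w) α} (sort-sorted w) (cnt→content (sort w) content*)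
    unique : ∀ u → sortedWithContent u ≡ true → u ≡ u*
    unique u p with ∧-true {weakInc (toList u)} {hasContent (toList u) α} p
    ... | su , cu = toList-injective u u* (trans (sorted-unique (toList u) (sort w) su (sort-sorted w)
                      (λ i → trans (content→cnt (toList u) cu i) (sym (content* i)))) (sym (proj₂ sorted-w)))

  module _ (n L k : ℕ) (shape : suc L ℕ.+ k ≡ suc n) where
    private
      N = suc n
      words = allVecsOf (allFin m) N
      rows = allVecsOf (allFin m) (suc L)
      legs = allVecsOf (allFin m) k
      hookFilling : Vec F (suc L) → Vec F k → Bool
      hookFilling r v = tableauOK (toList r ∷ column (toList v))

    -- Every hook tableau contributes the factor Σ_u [u sorted with content α] = 1.
    attach-sorted-word : (r : Vec F (suc L)) (v : Vec F k) → ι (hookFilling r v) ≡ Σ words (λ u → ι (sortedWithContent u)) * ι (hookFilling r v)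
    attach-sorted-word r v with hookFilling r v in ok
    ... | false = sym (ℤP.*-zeroʳ (Σ words (λ u → ι (sortedWithContent u))))
    ... | true = sym (trans (cong (_* + 1) (unique-sorted-word N reading len content)) refl)
      where
      reading = List.concat (toList r ∷ column (toList v))
      content : hasContent reading α ≡ true
      content = proj₂ (∧-true {isSSYT (toList r ∷ column (toList v))} {hasContent reading α} ok)
      len : List.length reading ≡ N
      len = trans (ListP.length-++ (toList r)) (trans (cong₂ ℕ._+_ (VecP.length-toList r)
              (trans (cong List.length (concat-column (toList v))) (VecP.length-toList v))) shape)

    tableaux-of-sorted : (u : Vec F N) →
      ι (sortedWithContent u) * Σ legs (λ v → Σ rows (λ r → ι (hookFilling r v))) ≡ ι (sortedWithContent u) * + (∣ Unrolling.ascents u ∣ C k)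
    tableaux-of-sorted (h Vec.∷ v0) = ι-*-cong (sortedWithContent (h Vec.∷ v0)) λ ok →
      let sorted , content = ∧-true {weakInc (h ∷ toList v0)} {hasContent (h ∷ toList v0) α} ok in
      trans (HookShape.Legs.hook-tableaux-count α h (toList v0) sorted (content→cnt (h ∷ toList v0) content) L k
               (trans (cong suc (VecP.length-toList v0)) (sym shape)))
            (cong (λ z → + (z C k)) (sym (ascents-∷ h v0)))

    hook-schur : + countL tableauOK (fillings (suc L ∷ List.replicate k 1)) ≡ ascentSum n k α
    hook-schur = begin
      + countL tableauOK (fillings (suc L ∷ List.replicate k 1))
        ≡⟨ countL-Σ tableauOK (fillings (suc L ∷ List.replicate k 1)) ⟩
      Σ (fillings (suc L ∷ List.replicate k 1)) (λ T → ι (tableauOK T))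
        ≡⟨ Σ-concatMap (λ r → map (toList r ∷_) (fillings (List.replicate k 1))) rows (λ T → ι (tableauOK T)) ⟩
      Σ rows (λ r → Σ (map (toList r ∷_) (fillings (List.replicate k 1))) (λ T → ι (tableauOK T)))
        ≡⟨ Σ-cong rows (λ r → trans (Σ-map (toList r ∷_) (fillings (List.replicate k 1)) (λ T → ι (tableauOK T)))
                                    (Σ-column-fillings k (λ C → ι (tableauOK (toList r ∷ C))))) ⟩
      Σ rows (λ r → Σ legs (λ v → ι (hookFilling r v)))
        ≡⟨ Σ-cong rows (λ r → Σ-cong legs (λ v → trans (attach-sorted-word r v) (sym (Σ-*ʳ words (ι (hookFilling r v)) _)))) ⟩
      Σ rows (λ r → Σ legs (λ v → Σ words (λ u → ι (sortedWithContent u) * ι (hookFilling r v))))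
        ≡⟨ trans (Σ-cong rows (λ r → Σ-swap legs words _)) (Σ-swap rows words _) ⟩
      Σ words (λ u → Σ rows (λ r → Σ legs (λ v → ι (sortedWithContent u) * ι (hookFilling r v))))
        ≡⟨ Σ-cong words (λ u → trans (Σ-cong rows (λ r → Σ-*ˡ legs (ι (sortedWithContent u)) _))
                                      (trans (Σ-*ˡ rows (ι (sortedWithContent u)) _)
                                             (cong (ι (sortedWithContent u) *_) (Σ-swap rows legs _)))) ⟩
      Σ words (λ u → ι (sortedWithContent u) * Σ legs (λ v → Σ rows (λ r → ι (hookFilling r v))))
        ≡⟨ Σ-cong words tableaux-of-sorted ⟩
      Σ words (λ u → ι (sortedWithContent u) * + (∣ Unrolling.ascents u ∣ C k))
        ≡⟨ Σ-cong words sorted≡increasing ⟩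
      ascentSum n k α ∎
      where
      open ≡-Reasoning
      sorted≡increasing : ∀ u → ι (sortedWithContent u) * + (∣ Unrolling.ascents u ∣ C k)
        ≡ ι (Unrolling.weaklyIncreasing u ∧ hasContent (toList u) α) * + (∣ Unrolling.ascents u ∣ C k)
      sorted≡increasing (a Vec.∷ v) = cong (λ z → ι (z ∧ hasContent (toList (a Vec.∷ v)) α) * + (∣ Unrolling.ascents (a Vec.∷ v) ∣ C k))
        (sym (weaklyIncreasing-∷ a v))

  schur-hook-ascents : (n k : ℕ) → k ≤ n → + schurCoeff (hook (suc n) k) α ≡ ascentSum n k α
  schur-hook-ascents n k k≤n = trans (cong (λ L → + countL tableauOK (fillings (L ∷ List.replicate k 1))) (ℕP.+-∸-assoc 1 k≤n))
    (hook-schur n (n ∸ k) k (cong suc (ℕP.m∸n+n≡m k≤n)))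

-- (D) Orbits of the cyclic shift on subsets

lex-refl : {n : ℕ} (a : Subset n) → lexLeq a a ≡ true
lex-refl Vec.[] = refl
lex-refl (false Vec.∷ a) = lex-refl a
lex-refl (true Vec.∷ a) = lex-refl a

lex-total : {n : ℕ} (a b : Subset n) → lexLeq a b ≡ false → lexLeq b a ≡ true
lex-total Vec.[] Vec.[] ()
lex-total (false Vec.∷ a) (false Vec.∷ b) h = lex-total a b h
lex-total (true Vec.∷ a) (true Vec.∷ b) h = lex-total a b h
lex-total (true Vec.∷ a) (false Vec.∷ b) h = refl

lex-antisym : {n : ℕ} (a b : Subset n) → lexLeq a b ≡ true → lexLeq b a ≡ true → a ≡ b
lex-antisym Vec.[] Vec.[] p q = refl
lex-antisym (false Vec.∷ a) (false Vec.∷ b) p q = cong (false Vec.∷_) (lex-antisym a b p q)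
lex-antisym (true Vec.∷ a) (true Vec.∷ b) p q = cong (true Vec.∷_) (lex-antisym a b p q)

lex-trans : {n : ℕ} (a b c : Subset n) → lexLeq a b ≡ true → lexLeq b c ≡ true → lexLeq a c ≡ true
lex-trans Vec.[] Vec.[] Vec.[] p q = refl
lex-trans (false Vec.∷ a) (false Vec.∷ b) (false Vec.∷ c) p q = lex-trans a b c p q
lex-trans (false Vec.∷ a) (false Vec.∷ b) (true Vec.∷ c) p q = refl
lex-trans (false Vec.∷ a) (true Vec.∷ b) (true Vec.∷ c) p q = refl
lex-trans (true Vec.∷ a) (true Vec.∷ b) (true Vec.∷ c) p q = lex-trans a b c p q

eqSub-sound : {n : ℕ} (a b : Subset n) → eqSub a b ≡ true → a ≡ b
eqSub-sound Vec.[] Vec.[] h = refl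
eqSub-sound (true Vec.∷ a) (true Vec.∷ b) h = cong (true Vec.∷_) (eqSub-sound a b h)
eqSub-sound (false Vec.∷ a) (false Vec.∷ b) h = cong (false Vec.∷_) (eqSub-sound a b h)

eqSub-refl : {n : ℕ} (a : Subset n) → eqSub a a ≡ true
eqSub-refl Vec.[] = refl
eqSub-refl (true Vec.∷ a) = eqSub-refl a
eqSub-refl (false Vec.∷ a) = eqSub-refl a

eqSub-δ : {n : ℕ} (a b : Subset n) → ι (eqSub a b) ≡ δ (eq (EnumSub n)) a b
eqSub-δ a b with eqSub a b in e
... | true = sym (δ-yes (eq (EnumSub _)) (eqSub-sound a b e))
... | false = sym (δ-no (eq (EnumSub _)) (λ q → true≢false (trans (sym (subst (λ z → eqSub a z ≡ true) q (eqSub-refl a))) e)))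

argmin : {N M : ℕ} → (Fin (suc N) → Subset M) → Fin (suc N)
argmin {zero} f = Fin.zero
argmin {suc N} f = if lexLeq (f Fin.zero) (f t) then Fin.zero else t
  where t = Fin.suc (argmin (λ i → f (Fin.suc i)))

argmin-minimal : {N M : ℕ} (f : Fin (suc N) → Subset M) → ∀ s → lexLeq (f (argmin f)) (f s) ≡ true
argmin-minimal {zero} f Fin.zero = lex-refl (f Fin.zero)
argmin-minimal {suc N} f s with lexLeq (f Fin.zero) (f (Fin.suc (argmin (λ i → f (Fin.suc i))))) in e
argmin-minimal {suc N} f Fin.zero | true = lex-refl (f Fin.zero)
argmin-minimal {suc N} f (Fin.suc s) | true = lex-trans (f Fin.zero) _ (f (Fin.suc s)) e (argmin-minimal (λ i → f (Fin.suc i)) s)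
argmin-minimal {suc N} f Fin.zero | false = lex-total (f Fin.zero) _ e
argmin-minimal {suc N} f (Fin.suc s) | false = argmin-minimal (λ i → f (Fin.suc i)) s

module Orbits {n : ℕ} where
  open Cyclic {n}
  private
    N = suc n
    subsets = allSubsets N

  shiftsTo : Subset N → Subset N → ℕ
  shiftsTo R J = countL (λ s → eqSub (shift s R) J) (allFin N)

  sameOrbit : Subset N → Subset N → Bool
  sameOrbit R J = 0 <ᵇ shiftsTo R J

  orbitSize : Subset N → ℕ
  orbitSize R = countL (sameOrbit R) subsets

  shiftsTo-shift : (R : Subset N) (s0 : Fin N) → shiftsTo R (shift s0 R) ≡ stabOrder R
  shiftsTo-shift R s0 = +-inj (begin
    + shiftsTo R (shift s0 R)                                        ≡⟨ countL-Σ _ (allFin N) ⟩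
    Σ (allFin N) (λ s → ι (eqSub (rot s R) (rot s0 R)))               ≡⟨ sym (Σ-translate s0 (λ s → ι (eqSub (rot s R) (rot s0 R)))) ⟩
    Σ (allFin N) (λ s → ι (eqSub (rot (addMod s s0) R) (rot s0 R)))   ≡⟨ Σ-cong (allFin N) cancel-s0 ⟩
    Σ (allFin N) (λ s → ι (eqSub (rot s R) R))                        ≡⟨ sym (countL-Σ _ (allFin N)) ⟩
    + stabOrder R ∎)
    where
    open ≡-Reasoning
    rot-+ : ∀ s → rot s0 (rot s R) ≡ rot (addMod s s0) R
    rot-+ s = trans (rot-comp s s0 R) (cong (λ z → rot z R) (addMod-comm s0 s))
    cancel-s0 : ∀ s → ι (eqSub (rot (addMod s s0) R) (rot s0 R)) ≡ ι (eqSub (rot s R) R)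
    cancel-s0 s = trans (eqSub-δ _ _) (trans (δ-iff (eq (EnumSub N)) (eq (EnumSub N))
      (λ q → rot-injective s0 (rot s R) R (trans (rot-+ s) q))
      (λ q → trans (sym (rot-+ s)) (cong (rot s0) q))) (sym (eqSub-δ _ _)))

  sameOrbit→ : (R J : Subset N) → sameOrbit R J ≡ true → ∃ λ s → shift s R ≡ J
  sameOrbit→ R J h with countL-witness (λ s → eqSub (shift s R) J) (allFin N) (ℕP.<ᵇ⇒< 0 _ (≡→T h))
  ... | s , e = s , eqSub-sound (shift s R) J e

  →sameOrbit : (R : Subset N) (s : Fin N) → sameOrbit R (shift s R) ≡ true
  →sameOrbit R s = T→≡ (ℕP.<⇒<ᵇ (countFin-pos (λ t → eqSub (shift t R) (shift s R)) s (eqSub-refl (shift s R))))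

  orbit-stabilizer : (R : Subset N) → orbitSize R ℕ.* stabOrder R ≡ N
  orbit-stabilizer R = +-inj (begin
    + (orbitSize R ℕ.* stabOrder R)                           ≡⟨ ℤP.pos-* (orbitSize R) (stabOrder R) ⟩
    + orbitSize R * + stabOrder R                             ≡⟨ cong (_* + stabOrder R) (countL-Σ (sameOrbit R) subsets) ⟩
    Σ subsets (λ J → ι (sameOrbit R J)) * + stabOrder R       ≡⟨ sym (Σ-*ʳ subsets (+ stabOrder R) _) ⟩
    Σ subsets (λ J → ι (sameOrbit R J) * + stabOrder R)       ≡⟨ Σ-cong subsets by-orbit-point ⟩
    Σ subsets (λ J → + shiftsTo R J)                          ≡⟨ Σ-cong subsets (λ J → countL-Σ _ (allFin N)) ⟩
    Σ subsets (λ J → Σ (allFin N) (λ s → ι (eqSub (shift s R) J))) ≡⟨ Σ-swap subsets (allFin N) _ ⟩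
    Σ (allFin N) (λ s → Σ subsets (λ J → ι (eqSub (shift s R) J))) ≡⟨ Σ-cong (allFin N) (λ s → hit-once (shift s R)) ⟩
    Σ (allFin N) (λ s → + 1)                                  ≡⟨ Σ-const N (+ 1) ⟩
    + N * + 1                                                 ≡⟨ ℤP.*-identityʳ (+ N) ⟩
    + N ∎)
    where
    open ≡-Reasoning
    hit-once : ∀ X → Σ subsets (λ J → ι (eqSub X J)) ≡ + 1
    hit-once X = trans (Σ-cong subsets (λ J → trans (eqSub-δ X J) (δ-sym (eq (EnumSub N)) X J))) (once (EnumSub N) X)
    by-orbit-point : ∀ J → ι (sameOrbit R J) * + stabOrder R ≡ + shiftsTo R J
    by-orbit-point J with shiftsTo R J in e
    ... | zero = refl
    ... | suc c with sameOrbit→ R J (T→≡ (ℕP.<⇒<ᵇ (subst (0 <_) (sym e) (ℕ.s≤s ℕ.z≤n))))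
    ... | s , refl = trans (ℤP.*-identityˡ (+ stabOrder R)) (cong +_ (trans (sym (shiftsTo-shift R s)) e))

  orbitMin : Subset N → Subset N
  orbitMin J = shift (argmin (λ s → shift s J)) J

  orbitMin-isRep : (J : Subset N) → isOrbitRep (orbitMin J) ≡ true
  orbitMin-isRep J = →allB (λ t → lexLeq (orbitMin J) (shift t (orbitMin J)))
    (λ t → subst (λ z → lexLeq (orbitMin J) z ≡ true) (sym (rot-comp s0 t J)) (argmin-minimal (λ s → shift s J) (addMod t s0)))
    where s0 = argmin (λ s → shift s J)

  unique-representative : (J : Subset N) → Σ subsets (λ R → ι (isOrbitRep R ∧ sameOrbit R J)) ≡ + 1
  unique-representative J = trans (Σ-unique (EnumSub N) (λ R → isOrbitRep R ∧ sameOrbit R J) (orbitMin J) unique) (cong ι min-ok)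
    where
    s0 = argmin (λ s → shift s J)
    min-ok : (isOrbitRep (orbitMin J) ∧ sameOrbit (orbitMin J) J) ≡ true
    min-ok = ∧-intro {isOrbitRep (orbitMin J)} {sameOrbit (orbitMin J) J} (orbitMin-isRep J)
      (subst (λ z → sameOrbit (orbitMin J) z ≡ true) (rot-inv s0 J) (→sameOrbit (orbitMin J) (negMod s0)))
    unique : ∀ R → (isOrbitRep R ∧ sameOrbit R J) ≡ true → R ≡ orbitMin J
    unique R h with ∧-true {isOrbitRep R} {sameOrbit R J} h
    ... | rep , same with sameOrbit→ R J same
    ... | s , refl = lex-antisym R (orbitMin J) R≤min min≤R
      where
      min≡ : orbitMin J ≡ rot (addMod s0 s) R
      min≡ = rot-comp s s0 R
      R≤min : lexLeq R (orbitMin J) ≡ true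
      R≤min = subst (λ z → lexLeq R z ≡ true) (sym min≡) (allB→ (λ t → lexLeq R (shift t R)) rep (addMod s0 s))
      R≡ : R ≡ rot (negMod (addMod s0 s)) (orbitMin J)
      R≡ = sym (trans (cong (rot (negMod (addMod s0 s))) min≡) (rot-inv (addMod s0 s) R))
      min≤R : lexLeq (orbitMin J) R ≡ true
      min≤R = subst (λ z → lexLeq (orbitMin J) z ≡ true) (sym R≡)
        (allB→ (λ t → lexLeq (orbitMin J) (shift t (orbitMin J))) (orbitMin-isRep J) (negMod (addMod s0 s)))

  Σ-orbits : (G : Subset N → ℤ) → (∀ s J → G (shift s J) ≡ G J) →
    Σ subsets G ≡ Σ subsets (λ R → ι (isOrbitRep R) * (+ orbitSize R * G R))
  Σ-orbits G invariant = begin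
    Σ subsets G
      ≡⟨ Σ-cong subsets (λ J → sym (trans (cong (_* G J) (unique-representative J)) (ℤP.*-identityˡ (G J)))) ⟩
    Σ subsets (λ J → Σ subsets (λ R → ι (isOrbitRep R ∧ sameOrbit R J)) * G J)
      ≡⟨ Σ-cong subsets (λ J → sym (Σ-*ʳ subsets (G J) _)) ⟩
    Σ subsets (λ J → Σ subsets (λ R → ι (isOrbitRep R ∧ sameOrbit R J) * G J))
      ≡⟨ Σ-swap subsets subsets _ ⟩
    Σ subsets (λ R → Σ subsets (λ J → ι (isOrbitRep R ∧ sameOrbit R J) * G J))
      ≡⟨ Σ-cong subsets (λ R → Σ-cong subsets (λ J → move-to-rep R J)) ⟩
    Σ subsets (λ R → Σ subsets (λ J → ι (isOrbitRep R) * (ι (sameOrbit R J) * G R)))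
      ≡⟨ Σ-cong subsets (λ R → trans (Σ-*ˡ subsets (ι (isOrbitRep R)) _) (cong (ι (isOrbitRep R) *_)
           (trans (Σ-*ʳ subsets (G R) _) (cong (_* G R) (sym (countL-Σ (sameOrbit R) subsets)))))) ⟩
    Σ subsets (λ R → ι (isOrbitRep R) * (+ orbitSize R * G R)) ∎
    where
    open ≡-Reasoning
    move-to-rep : ∀ R J → ι (isOrbitRep R ∧ sameOrbit R J) * G J ≡ ι (isOrbitRep R) * (ι (sameOrbit R J) * G R)
    move-to-rep R J with sameOrbit R J in e
    ... | false = trans (cong (λ z → ι z * G J) (BoolP.∧-zeroʳ (isOrbitRep R)))
                   (trans (ℤP.*-zeroˡ (G J)) (sym (trans (cong (ι (isOrbitRep R) *_) (ℤP.*-zeroˡ (G R))) (ℤP.*-zeroʳ (ι (isOrbitRep R))))))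
    ... | true with sameOrbit→ R J e
    ... | s , refl = trans (cong (λ z → ι z * G (shift s R)) (BoolP.∧-identityʳ (isOrbitRep R)))
                       (cong (ι (isOrbitRep R) *_) (trans (invariant s R) (sym (ℤP.*-identityˡ (G R)))))

  -- d_J ≥ 1, since the zero shift fixes J.
  stabOrder-pos : (J : Subset N) → Σ[ d ∈ ℕ ] stabOrder J ≡ suc d
  stabOrder-pos J with stabOrder J in e
  ... | zero = ⊥-elim (ℕP.<-irrefl (sym e) (countFin-pos (λ s → eqSub (shift s J) J) Fin.zero
                 (subst (λ z → eqSub z J ≡ true) (sym (rot-zero J)) (eqSub-refl J))))
  ... | suc d = d , refl

toℚ : ℤ → ℚ
toℚ z = z ℚ./ 1

-- 1/d (the value at d = 0 is irrelevant)
recip : ℕ → ℚ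
recip zero = 0ℚ
recip (suc d) = + 1 ℚ./ suc d

toℚᵘ-toℚ : (z : ℤ) → ℚ.toℚᵘ (toℚ z) ℚᵘ.≃ mkℚᵘ z 0
toℚᵘ-toℚ z = ℚP.toℚᵘ-fromℚᵘ (mkℚᵘ z 0)

toℚᵘ-recip : (d : ℕ) → ℚ.toℚᵘ (recip (suc d)) ℚᵘ.≃ mkℚᵘ (+ 1) d
toℚᵘ-recip d = ℚP.toℚᵘ-fromℚᵘ (mkℚᵘ (+ 1) d)

toℚ-+ : (a b : ℤ) → toℚ (a + b) ≡ toℚ a ℚ.+ toℚ b
toℚ-+ a b = ℚP.toℚᵘ-injective (begin
  ℚ.toℚᵘ (toℚ (a + b))                   ≈⟨ toℚᵘ-toℚ (a + b) ⟩
  mkℚᵘ (a + b) 0                          ≈⟨ *≡* (cong (_* + 1) (sym (cong₂ _+_ (ℤP.*-identityʳ a) (ℤP.*-identityʳ b)))) ⟩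
  mkℚᵘ a 0 ℚᵘ.+ mkℚᵘ b 0                 ≈⟨ ℚᵘP.≃-sym (ℚᵘP.+-cong (toℚᵘ-toℚ a) (toℚᵘ-toℚ b)) ⟩
  ℚ.toℚᵘ (toℚ a) ℚᵘ.+ ℚ.toℚᵘ (toℚ b)   ≈⟨ ℚᵘP.≃-sym (ℚP.toℚᵘ-homo-+ (toℚ a) (toℚ b)) ⟩
  ℚ.toℚᵘ (toℚ a ℚ.+ toℚ b) ∎)
  where open ℚᵘP.≃-Reasoning

toℚ-* : (a b : ℤ) → toℚ (a * b) ≡ toℚ a ℚ.* toℚ b
toℚ-* a b = ℚP.toℚᵘ-injective (begin
  ℚ.toℚᵘ (toℚ (a * b))                   ≈⟨ toℚᵘ-toℚ (a * b) ⟩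
  mkℚᵘ (a * b) 0                          ≈⟨ *≡* refl ⟩
  mkℚᵘ a 0 ℚᵘ.* mkℚᵘ b 0                 ≈⟨ ℚᵘP.≃-sym (ℚᵘP.*-cong (toℚᵘ-toℚ a) (toℚᵘ-toℚ b)) ⟩
  ℚ.toℚᵘ (toℚ a) ℚᵘ.* ℚ.toℚᵘ (toℚ b)   ≈⟨ ℚᵘP.≃-sym (ℚP.toℚᵘ-homo-* (toℚ a) (toℚ b)) ⟩
  ℚ.toℚᵘ (toℚ a ℚ.* toℚ b) ∎)
  where open ℚᵘP.≃-Reasoning

recip-split : (o d' N' : ℕ) → o ℕ.* suc d' ≡ suc N' → toℚ (+ o) ℚ.* recip (suc N') ≡ recip (suc d')
recip-split o d' N' e = ℚP.toℚᵘ-injective (begin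
  ℚ.toℚᵘ (toℚ (+ o) ℚ.* recip (suc N'))               ≈⟨ ℚP.toℚᵘ-homo-* (toℚ (+ o)) (recip (suc N')) ⟩
  ℚ.toℚᵘ (toℚ (+ o)) ℚᵘ.* ℚ.toℚᵘ (recip (suc N'))    ≈⟨ ℚᵘP.*-cong (toℚᵘ-toℚ (+ o)) (toℚᵘ-recip N') ⟩
  mkℚᵘ (+ o) 0 ℚᵘ.* mkℚᵘ (+ 1) N'                     ≈⟨ *≡* cross ⟩
  mkℚᵘ (+ 1) d'                                        ≈⟨ ℚᵘP.≃-sym (toℚᵘ-recip d') ⟩
  ℚ.toℚᵘ (recip (suc d')) ∎)
  where
  open ℚᵘP.≃-Reasoning
  cross : (+ o * + 1) * + suc d' ≡ + 1 * + (suc N' ℕ.+ 0)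
  cross = trans (cong (_* + suc d') (ℤP.*-identityʳ (+ o))) (trans (sym (ℤP.pos-* o (suc d')))
    (trans (cong +_ e) (sym (trans (ℤP.*-identityˡ (+ (suc N' ℕ.+ 0))) (cong +_ (ℕP.+-identityʳ _))))))

sumℚ-cong : {A : Set} (l : List A) {f g : A → ℚ} → (∀ x → f x ≡ g x) → sumℚ (map f l) ≡ sumℚ (map g l)
sumℚ-cong [] e = refl
sumℚ-cong (x ∷ l) e = cong₂ ℚ._+_ (e x) (sumℚ-cong l e)

sumℚ-toℚ : {A : Set} (l : List A) (X : A → ℤ) (c : ℚ) → sumℚ (map (λ x → toℚ (X x) ℚ.* c) l) ≡ toℚ (Σ l X) ℚ.* c
sumℚ-toℚ [] X c = sym (ℚP.*-zeroˡ c)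
sumℚ-toℚ (x ∷ l) X c = trans (cong (toℚ (X x) ℚ.* c ℚ.+_) (sumℚ-toℚ l X c))
  (trans (sym (ℚP.*-distribʳ-+ c (toℚ (X x)) _)) (cong (ℚ._* c) (sym (toℚ-+ (X x) _))))

-- (D) The orbit form: the summand of rhsOrbits at a representative J is
-- |orbit J| · (signed term of J) / N, because d_J = N / |orbit J|.

module OrbitSide {n m : ℕ} (k : ℕ) (α : Fin m → ℕ) where
  open SubsetSide {n} k α
  open Orbits {n}
  private
    N = suc n
    1/N = recip N

  weightedTerm : Subset N → ℤ
  weightedTerm J = ι (isOrbitRep J) * (+ orbitSize J * signedTerm J)

  orbitTerm-eq : (J : Subset N) →
    (if isOrbitRep J ∧ (0 <ᵇ ∣ J ∣) ∧ (k <ᵇ ∣ J ∣)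
      then (signPow (∣ J ∣ ∸ k ∸ 1) ℚ./ 1) ℚ.* fcycHatCoeff J α
      else 0ℚ) ≡ toℚ (weightedTerm J) ℚ.* 1/N
  orbitTerm-eq J with isOrbitRep J | k <ᵇ ∣ J ∣ in k<J
  ... | false | _ = sym (trans (cong (λ z → toℚ z ℚ.* 1/N) (ℤP.*-zeroˡ (+ orbitSize J * signedTerm J))) (ℚP.*-zeroˡ 1/N))
  ... | true | false = trans (cong (λ b → if b then (signPow (∣ J ∣ ∸ k ∸ 1) ℚ./ 1) ℚ.* fcycHatCoeff J α else 0ℚ) (BoolP.∧-zeroʳ (0 <ᵇ ∣ J ∣)))
      (sym (trans (cong (λ z → toℚ (+ 1 * z) ℚ.* 1/N) (ℤP.*-zeroʳ (+ orbitSize J))) (ℚP.*-zeroˡ 1/N)))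
  ... | true | true with stabOrder-pos J
  ... | d , stab = begin
      (if (0 <ᵇ ∣ J ∣) ∧ true then toℚ σ ℚ.* fcycHatCoeff J α else 0ℚ)
        ≡⟨ cong (λ b → if b then toℚ σ ℚ.* fcycHatCoeff J α else 0ℚ) (trans (BoolP.∧-identityʳ _) J-nonempty) ⟩
      toℚ σ ℚ.* divℕ (toℚ (+ f)) (stabOrder J)
        ≡⟨ cong (λ z → toℚ σ ℚ.* divℕ (toℚ (+ f)) z) stab ⟩
      toℚ σ ℚ.* (toℚ (+ f) ℚ.* recip (suc d))
        ≡⟨ sym (ℚP.*-assoc (toℚ σ) (toℚ (+ f)) (recip (suc d))) ⟩
      toℚ σ ℚ.* toℚ (+ f) ℚ.* recip (suc d)
        ≡⟨ cong₂ ℚ._*_ (sym (toℚ-* σ (+ f))) (sym (recip-split (orbitSize J) d n orbit·d≡N)) ⟩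
      toℚ (σ * + f) ℚ.* (toℚ (+ orbitSize J) ℚ.* 1/N)
        ≡⟨ sym (ℚP.*-assoc (toℚ (σ * + f)) (toℚ (+ orbitSize J)) 1/N) ⟩
      toℚ (σ * + f) ℚ.* toℚ (+ orbitSize J) ℚ.* 1/N
        ≡⟨ cong (ℚ._* 1/N) (trans (sym (toℚ-* (σ * + f) (+ orbitSize J))) (cong toℚ (ℤP.*-comm (σ * + f) _))) ⟩
      toℚ (+ orbitSize J * (σ * + f)) ℚ.* 1/N
        ≡⟨ cong (λ z → toℚ z ℚ.* 1/N) (sym (ℤP.*-identityˡ (+ orbitSize J * (σ * + f)))) ⟩
      toℚ (+ 1 * (+ orbitSize J * (σ * + f))) ℚ.* 1/N ∎
    where
    open ≡-Reasoning
    σ = signPow (∣ J ∣ ∸ k ∸ 1)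
    f = fcycCoeff J α
    J-nonempty : (0 <ᵇ ∣ J ∣) ≡ true
    J-nonempty = T→≡ (ℕP.<⇒<ᵇ (ℕP.<-≤-trans (ℕ.s≤s ℕ.z≤n) (ℕP.<ᵇ⇒< k ∣ J ∣ (≡→T k<J))))
    orbit·d≡N : orbitSize J ℕ.* suc d ≡ N
    orbit·d≡N = trans (cong (orbitSize J ℕ.*_) (sym stab)) (orbit-stabilizer J)

  rhsOrbits-subsets : rhsOrbits N k α ≡ toℚ (rhsSubsets N k α) ℚ.* 1/N
  rhsOrbits-subsets = begin
    rhsOrbits N k α                                        ≡⟨ sumℚ-cong (allSubsets N) orbitTerm-eq ⟩
    sumℚ (map (λ J → toℚ (weightedTerm J) ℚ.* 1/N) (allSubsets N)) ≡⟨ sumℚ-toℚ (allSubsets N) weightedTerm 1/N ⟩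
    toℚ (Σ (allSubsets N) weightedTerm) ℚ.* 1/N         ≡⟨ cong (λ z → toℚ z ℚ.* 1/N) (sym (Σ-orbits signedTerm signedTerm-rot)) ⟩
    toℚ (rhsSubsets N k α) ℚ.* 1/N ∎
    where open ≡-Reasoning

proposition4p9 : (n k : ℕ) → 1 ≤ n → k ≤ n ∸ 1 →
    (m : ℕ) (α : Fin m → ℕ) →
    ((+ n) ℤ.* (+ schurCoeff (hook n k) α) ≡ rhsSubsets n k α)
    × ((+ schurCoeff (hook n k) α) ℚ./ 1 ≡ rhsOrbits n k α)
proposition4p9 (suc n) k _ k≤n m α = subset-form , orbit-form
  where
  open ≡-Reasoning
  s = schurCoeff (hook (suc n) k) α
  -- (A) and (C): both sides equal N · ascentSum.
  subset-form : + suc n * + s ≡ rhsSubsets (suc n) k α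
  subset-form = trans (cong (+ suc n *_) (HookSchur.schur-hook-ascents α n k k≤n))
                      (sym (SubsetSide.rhsSubsets-ascents {n} k α))
  orbit-form : toℚ (+ s) ≡ rhsOrbits (suc n) k α
  orbit-form = sym (begin
    rhsOrbits (suc n) k α                             ≡⟨ OrbitSide.rhsOrbits-subsets {n} k α ⟩
    toℚ (rhsSubsets (suc n) k α) ℚ.* recip (suc n)    ≡⟨ cong (λ z → toℚ z ℚ.* recip (suc n)) (sym subset-form) ⟩
    toℚ (+ suc n * + s) ℚ.* recip (suc n)             ≡⟨ cong (ℚ._* recip (suc n)) (trans (toℚ-* (+ suc n) (+ s)) (ℚP.*-comm (toℚ (+ suc n)) (toℚ (+ s)))) ⟩
    toℚ (+ s) ℚ.* toℚ (+ suc n) ℚ.* recip (suc n)     ≡⟨ ℚP.*-assoc (toℚ (+ s)) _ _ ⟩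
    toℚ (+ s) ℚ.* (toℚ (+ suc n) ℚ.* recip (suc n))   ≡⟨ cong (toℚ (+ s) ℚ.*_) (recip-split (suc n) 0 n (ℕP.*-identityʳ (suc n))) ⟩
    toℚ (+ s) ℚ.* 1ℚ                                  ≡⟨ ℚP.*-identityʳ (toℚ (+ s)) ⟩
    toℚ (+ s) ∎)
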